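{- Let $k$ be a positive integer, $a=6k+5$, $b=2a-6$, $c=2a-4$ and $S=\{a,b,c\}=\{6k+5,12k+4,12k+6\}$. Then $x\in\langle S\rangle$ if and only if $x=(s+2q)a-6q+2r$ for some $q,r,s\in\mathbb{N}$ with $0\le r\le q$; moreover $[(4k+1)a+3,\infty[\,\subseteq\langle S\rangle$ and $\langle S\rangle$ is a $3$-permutation numerical semigroup.
   Context: $[u,\infty[\,=\{x\in\mathbb{N}:x\ge u\}$. A numerical semigroup is a submonoid $G$ of $(\mathbb{N},+,0)$ with $\mathbb{N}\setminus G$ finite; $\langle S\rangle$ is the submonoid generated by $S$. Write the elements of $G$ as $0=g_0<g_1<g_2<\cdots$. For $n\ge 1$, $G$ is an $n$-permutation numerical semigroup if $G=\langle g_1,\dots,g_n\rangle$ and for every integer $k\ge 0$ the tuple $(g_{kn+1}\bmod n,\dots,g_{kn+n}\bmod n)$ contains exactly one representative of each residue class of $\mathbb{Z}/n\mathbb{Z}$. -}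

module Defs where

open import Data.Nat using (ℕ; zero; suc; _+_; _*_; _∸_; _≤_; _<_; NonZero)
open import Data.Nat.DivMod using (_%_)
open import Data.Fin using (Fin; toℕ)
open import Data.Product using (Σ; ∃; ∃!; _×_; _,_)
open import Data.Sum using (_⊎_)
open import Relation.Binary.PropositionalEquality using (_≡_)
open import Function.Bundles using (_⇔_)

data ⟨_⟩ (S : ℕ → Set) : ℕ → Set where
  gen-0 : ⟨ S ⟩ 0
  gen-∈ : ∀ {x} → S x → ⟨ S ⟩ x
  gen-+ : ∀ {x y} → ⟨ S ⟩ x → ⟨ S ⟩ y → ⟨ S ⟩ (x + y)

_≐_ : (ℕ → Set) → (ℕ → Set) → Set
G ≐ H = ∀ x → G x ⇔ H x

-- Numerical semigroup: submonoid of ℕ with finite complement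
-- (finite complement ⇔ complement bounded above).
record IsNumericalSemigroup (G : ℕ → Set) : Set where
  field
    zero∈ : G 0
    +-closed : ∀ {x y} → G x → G y → G (x + y)
    cofinite : ∃ λ F → ∀ x → F ≤ x → G x

IsIncreasingEnumeration : (ℕ → Set) → (ℕ → ℕ) → Set
IsIncreasingEnumeration G g =
  (∀ i → g i < g (suc i)) × (∀ x → G x ⇔ (∃ λ i → g i ≡ x))

IsPermutationNS : (n : ℕ) → .{{NonZero n}} → (ℕ → Set) → Set
IsPermutationNS n G =
  IsNumericalSemigroup G ×
  Σ (ℕ → ℕ) λ g →
    IsIncreasingEnumeration G g ×
    (G ≐ ⟨ (λ y → ∃ λ i → (1 ≤ i × i ≤ n) × g i ≡ y) ⟩) ×
    (∀ (k : ℕ) (r : Fin n) →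
       ∃! _≡_ (λ (i : Fin n) → g (k * n + suc (toℕ i)) % n ≡ toℕ r))

gen-a : ℕ → ℕ
gen-a k = 6 * k + 5

gen-b : ℕ → ℕ
gen-b k = 2 * gen-a k ∸ 6

gen-c : ℕ → ℕ
gen-c k = 2 * gen-a k ∸ 4

S₃ : ℕ → ℕ → Set
S₃ k x = x ≡ gen-a k ⊎ x ≡ gen-b k ⊎ x ≡ gen-c k

{-# OPTIONS --safe #-}
-- Write a = 6k + 5, so that b = 2a − 6 and c = 2a − 4.  Then s a + d b + r c = (s + 2q) a − 6q + 2r
-- with q = r + d, which is the representation of the first claim; equivalently, ⟨ S₃ k ⟩ is the union
-- of the layers N a − 2t with t = 0 or 2 ≤ t ≤ 3⌊N/2⌋.  Listing the layers in increasing order gives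
-- an explicit enumeration of ⟨ S₃ k ⟩, cut into windows of lengths divisible by 3 in which the two
-- gaps of every aligned block of three are congruent modulo 3 to the same nonzero residue, so every
-- block meets each residue class once.  From the conductor (4k + 1) a + 3 on, the enumeration runs
-- through consecutive integers.
module Submission where

open import Defs
open import Data.Nat
open import Data.Nat.Properties
open import Data.Nat.DivMod
open import Data.Nat.Tactic.RingSolver
open import Data.List using (_∷_; [])
open import Data.Bool using (Bool; true; false; _∨_)
open import Data.Bool.Properties using (T-≡; ∨-zeroʳ)
open import Data.Fin using (Fin; zero; suc; toℕ; fromℕ<)
open import Data.Fin.Properties using (all?; any?; toℕ-fromℕ<) renaming (_≟_ to _≟ᶠ_)
open import Data.Product
open import Data.Unit using (tt)
open import Data.Sum
open import Data.Empty
open import Relation.Nullary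
open import Relation.Nullary.Decidable using (toWitness; _×-dec_; _→-dec_)
open import Relation.Binary.Definitions using (tri<; tri≈; tri>)
open import Relation.Binary.PropositionalEquality
open ≡-Reasoning
open import Function.Bundles using (_⇔_; mk⇔; Equivalence)

-- Not defined by matching on refl: that would make Agda evaluate ring-solver proofs.
m+o≡n⇒m≤n : ∀ {m n} o → m + o ≡ n → m ≤ n
m+o≡n⇒m≤n {m} o eq = ≤-trans (m≤m+n m o) (≤-reflexive eq)

even⊎odd : ∀ n → ∃ λ w → n ≡ 2 * w ⊎ n ≡ 1 + 2 * w
even⊎odd zero = 0 , inj₁ refl
even⊎odd (suc n) with even⊎odd n
... | w , inj₁ refl = w , inj₂ refl
... | w , inj₂ refl = suc w , inj₁ (solve (w ∷ []))

mod3-cases : ∀ t → ∃ λ u → t ≡ 3 * u ⊎ t ≡ 1 + 3 * u ⊎ t ≡ 2 + 3 * u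
mod3-cases zero = 0 , inj₁ refl
mod3-cases (suc t) with mod3-cases t
... | u , inj₁ refl = u , inj₂ (inj₁ refl)
... | u , inj₂ (inj₁ refl) = u , inj₂ (inj₂ refl)
... | u , inj₂ (inj₂ refl) = suc u , inj₁ (solve (u ∷ []))

G : ℕ → ℕ → Set
G k = ⟨ S₃ k ⟩

-- Opaque, so that the type checker never evaluates the ring-solver proofs it is given.
opaque
  G-resp : ∀ k {x y} → x ≡ y → G k x → G k y
  G-resp k = subst (G k)

gen-b≡ : ∀ k → gen-b k ≡ 12 * k + 4
gen-b≡ k = trans (cong (_∸ 6) 2a≡) (m+n∸n≡m (12 * k + 4) 6)
  where 2a≡ : 2 * (6 * k + 5) ≡ 12 * k + 4 + 6
        2a≡ = solve (k ∷ [])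

gen-c≡ : ∀ k → gen-c k ≡ 12 * k + 6
gen-c≡ k = trans (cong (_∸ 4) 2a≡) (m+n∸n≡m (12 * k + 6) 4)
  where 2a≡ : 2 * (6 * k + 5) ≡ 12 * k + 6 + 4
        2a≡ = solve (k ∷ [])

a∈G : ∀ k → G k (6 * k + 5)
a∈G k = gen-∈ (inj₁ refl)

b∈G : ∀ k → G k (12 * k + 4)
b∈G k = G-resp k (gen-b≡ k) (gen-∈ (inj₂ (inj₁ refl)))

c∈G : ∀ k → G k (12 * k + 6)
c∈G k = G-resp k (gen-c≡ k) (gen-∈ (inj₂ (inj₂ refl)))

*-closed : ∀ k n {y} → G k y → G k (n * y)
*-closed k zero    y∈G = gen-0
*-closed k (suc n) y∈G = gen-+ y∈G (*-closed k n y∈G)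

Repr : ℕ → ℕ → Set
Repr k x = ∃ λ q → ∃ λ r → ∃ λ s → r ≤ q × x + 6 * q ≡ (s + 2 * q) * (6 * k + 5) + 2 * r

⟨S₃⟩⇒Repr : ∀ k {x} → G k x → Repr k x
⟨S₃⟩⇒Repr k gen-0 = 0 , 0 , 0 , z≤n , refl
⟨S₃⟩⇒Repr k (gen-∈ (inj₁ refl)) = 0 , 0 , 1 , z≤n , a≡
  where a≡ : 6 * k + 5 + 0 ≡ (1 + 0) * (6 * k + 5) + 0
        a≡ = solve (k ∷ [])
⟨S₃⟩⇒Repr k (gen-∈ (inj₂ (inj₁ refl))) =
  1 , 0 , 0 , z≤n , trans (cong (_+ 6) (gen-b≡ k)) (solve (k ∷ []))
⟨S₃⟩⇒Repr k (gen-∈ (inj₂ (inj₂ refl))) =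
  1 , 1 , 0 , s≤s z≤n , trans (cong (_+ 6) (gen-c≡ k)) (solve (k ∷ []))
⟨S₃⟩⇒Repr k (gen-+ {x} {y} x∈G y∈G)
  with q , r , s , r≤q , eq ← ⟨S₃⟩⇒Repr k x∈G
     | q′ , r′ , s′ , r′≤q′ , eq′ ← ⟨S₃⟩⇒Repr k y∈G =
  q + q′ , r + r′ , s + s′ , +-mono-≤ r≤q r′≤q′ , (begin
    x + y + 6 * (q + q′)
      ≡⟨ solve (x ∷ y ∷ q ∷ q′ ∷ []) ⟩
    (x + 6 * q) + (y + 6 * q′)
      ≡⟨ cong₂ _+_ eq eq′ ⟩
    ((s + 2 * q) * (6 * k + 5) + 2 * r) + ((s′ + 2 * q′) * (6 * k + 5) + 2 * r′)
      ≡⟨ solve (k ∷ s ∷ q ∷ r ∷ s′ ∷ q′ ∷ r′ ∷ []) ⟩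
    (s + s′ + 2 * (q + q′)) * (6 * k + 5) + 2 * (r + r′) ∎)

-- With q = r + d, the representation is x = s a + d b + r c.
Repr⇒⟨S₃⟩ : ∀ k {x} → Repr k x → G k x
Repr⇒⟨S₃⟩ k {x} (q , r , s , r≤q , eq) with d , refl ← m≤n⇒∃[o]m+o≡n r≤q =
  G-resp k (sym x≡) (gen-+ (gen-+ (*-closed k s (a∈G k)) (*-closed k d (b∈G k))) (*-closed k r (c∈G k)))
  where
  x≡ : x ≡ s * (6 * k + 5) + d * (12 * k + 4) + r * (12 * k + 6)
  x≡ = +-cancelʳ-≡ (6 * (r + d)) _ _ (begin
    x + 6 * (r + d)                        ≡⟨ eq ⟩
    (s + 2 * (r + d)) * (6 * k + 5) + 2 * r  ≡⟨ solve (k ∷ s ∷ d ∷ r ∷ []) ⟩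
    s * (6 * k + 5) + d * (12 * k + 4) + r * (12 * k + 6) + 6 * (r + d) ∎)

⟨S₃⟩⇔Repr : ∀ k x → G k x ⇔ Repr k x
⟨S₃⟩⇔Repr k x = mk⇔ (⟨S₃⟩⇒Repr k) (Repr⇒⟨S₃⟩ k)

-- Layer N = 2M + ε of the semigroup: the points N a − 2t with t = 0 (multiple) or 2 ≤ t ≤ 3M (dip).
data Layered (k x : ℕ) : Set where
  multiple : ∀ N → x ≡ N * (6 * k + 5) → Layered k x
  dip      : ∀ M ε t → ε ≤ 1 → 2 ≤ t → t ≤ 3 * M →
             x + 2 * t ≡ (2 * M + ε) * (6 * k + 5) → Layered k x

-- Take q = ⌈t/3⌉ and r = 3q − t ≤ 2.
dip∈G : ∀ k M ε t x → 2 ≤ t → t ≤ 3 * M → x + 2 * t ≡ (2 * M + ε) * (6 * k + 5) → G k x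
dip∈G k M ε t x 2≤t t≤3M eq with mod3-cases t
... | u , inj₁ refl with z , refl ← m≤n⇒∃[o]m+o≡n (*-cancelˡ-≤ {u} {M} 3 t≤3M) =
  Repr⇒⟨S₃⟩ k (u , 0 , ε + 2 * z , z≤n , (begin
    x + 6 * u                             ≡⟨ solve (x ∷ u ∷ []) ⟩
    x + 2 * (3 * u)                       ≡⟨ eq ⟩
    (2 * (u + z) + ε) * (6 * k + 5)         ≡⟨ solve (u ∷ z ∷ ε ∷ k ∷ []) ⟩
    (ε + 2 * z + 2 * u) * (6 * k + 5) + 2 * 0 ∎))
dip∈G k M ε t x (s≤s ()) t≤3M eq | zero , inj₂ (inj₁ refl)
... | suc u , inj₂ (inj₁ refl) with z , refl ← m≤n⇒∃[o]m+o≡n (*-cancelˡ-< 3 (suc u) M t≤3M) =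
  Repr⇒⟨S₃⟩ k (2 + u , 2 , ε + 2 * z , s≤s (s≤s z≤n) , (begin
    x + 6 * (2 + u)                       ≡⟨ solve (x ∷ u ∷ []) ⟩
    x + 2 * (1 + 3 * suc u) + 4           ≡⟨ cong (_+ 4) eq ⟩
    (2 * (suc (suc u) + z) + ε) * (6 * k + 5) + 4 ≡⟨ solve (u ∷ z ∷ ε ∷ k ∷ []) ⟩
    (ε + 2 * z + 2 * (2 + u)) * (6 * k + 5) + 2 * 2 ∎))
... | u , inj₂ (inj₂ refl)
  with z , refl ← m≤n⇒∃[o]m+o≡n (*-cancelˡ-< 3 u M (≤-trans (n≤1+n _) t≤3M)) =
  Repr⇒⟨S₃⟩ k (1 + u , 1 , ε + 2 * z , s≤s z≤n , (begin
    x + 6 * (1 + u)                       ≡⟨ solve (x ∷ u ∷ []) ⟩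
    x + 2 * (2 + 3 * u) + 2               ≡⟨ cong (_+ 2) eq ⟩
    (2 * (suc u + z) + ε) * (6 * k + 5) + 2 ≡⟨ solve (u ∷ z ∷ ε ∷ k ∷ []) ⟩
    (ε + 2 * z + 2 * (1 + u)) * (6 * k + 5) + 2 * 1 ∎))

Repr⇒Layered : ∀ k {x} → Repr k x → Layered k x
Repr⇒Layered k {x} (q , r , s , r≤q , eq) with d , refl ← m≤n⇒∃[o]m+o≡n r≤q = go r d eq
  where
  dip-from : ∀ r d → 2 ≤ 2 * r + 3 * d → x + 6 * (r + d) ≡ (s + 2 * (r + d)) * (6 * k + 5) + 2 * r →
             ∀ h ε → ε < 2 → s ≡ ε + h * 2 → Layered k x
  dip-from r d 2≤t eq h ε ε<2 refl =
    dip (h + (r + d)) ε (2 * r + 3 * d) (≤-pred ε<2) 2≤t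
      (m+o≡n⇒m≤n (3 * h + r) (solve (r ∷ d ∷ h ∷ []))) (+-cancelʳ-≡ (2 * r) _ _ (begin
        x + 2 * (2 * r + 3 * d) + 2 * r            ≡⟨ solve (x ∷ r ∷ d ∷ []) ⟩
        x + 6 * (r + d)                            ≡⟨ eq ⟩
        (ε + h * 2 + 2 * (r + d)) * (6 * k + 5) + 2 * r        ≡⟨ solve (ε ∷ h ∷ r ∷ d ∷ k ∷ []) ⟩
        (2 * (h + (r + d)) + ε) * (6 * k + 5) + 2 * r ∎))
  go : ∀ r d → x + 6 * (r + d) ≡ (s + 2 * (r + d)) * (6 * k + 5) + 2 * r → Layered k x
  go zero zero eq = multiple s (+-cancelʳ-≡ 0 _ _ (trans eq (solve (s ∷ k ∷ []))))
  go (suc r) d eq = dip-from (suc r) d (m+o≡n⇒m≤n (2 * r + 3 * d) (solve (r ∷ d ∷ [])))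
    eq (s / 2) (s % 2) (m%n<n s 2) (m≡m%n+[m/n]*n s 2)
  go zero (suc d) eq = dip-from 0 (suc d) (m+o≡n⇒m≤n (1 + 3 * d) (solve (d ∷ [])))
    eq (s / 2) (s % 2) (m%n<n s 2) (m≡m%n+[m/n]*n s 2)

conductor-even : ∀ k w → 2 * w < 6 * k + 5 → G k ((4 * k + 1) * (6 * k + 5) + 3 + 2 * w)
conductor-even k w 2w<a with w <? 3 * k
... | yes w<3k with e , h ← m≤n⇒∃[o]m+o≡n w<3k =
  dip∈G k (2 * k + 1) 0 (2 + e) _ (m≤m+n 2 e)
    (m+o≡n⇒m≤n (3 * k + w + 2) (begin
      2 + e + (3 * k + w + 2)  ≡⟨ solve (e ∷ k ∷ w ∷ []) ⟩
      suc w + e + 3 * k + 3    ≡⟨ cong (λ z → z + 3 * k + 3) h ⟩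
      3 * k + 3 * k + 3        ≡⟨ solve (k ∷ []) ⟩
      3 * (2 * k + 1)          ∎))
    (begin
      (4 * k + 1) * (6 * k + 5) + 3 + 2 * w + 2 * (2 + e)
        ≡⟨ solve (k ∷ w ∷ e ∷ []) ⟩
      (4 * k + 1) * (6 * k + 5) + 5 + 2 * (suc w + e)
        ≡⟨ cong (λ z → (4 * k + 1) * (6 * k + 5) + 5 + 2 * z) h ⟩
      (4 * k + 1) * (6 * k + 5) + 5 + 2 * (3 * k)
        ≡⟨ solve (k ∷ []) ⟩
      (2 * (2 * k + 1) + 0) * (6 * k + 5) ∎)
... | no w≮3k with m≤n⇒∃[o]m+o≡n (≮⇒≥ w≮3k)
...   | 0 , refl = dip∈G k (2 * k + 2) 0 (6 * k + 6) ((4 * k + 1) * (6 * k + 5) + 3 + 2 * (3 * k + 0))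
  (m+o≡n⇒m≤n (6 * k + 4) (solve (k ∷ []))) (m+o≡n⇒m≤n 0 (solve (k ∷ []))) (solve (k ∷ []))
...   | 1 , refl = G-resp k a-multiple (*-closed k (4 * k + 2) (a∈G k))
  where a-multiple : (4 * k + 2) * (6 * k + 5) ≡ (4 * k + 1) * (6 * k + 5) + 3 + 2 * (3 * k + 1)
        a-multiple = solve (k ∷ [])
...   | 2 , refl = dip∈G k (2 * k + 2) 0 (6 * k + 4) ((4 * k + 1) * (6 * k + 5) + 3 + 2 * (3 * k + 2))
  (m+o≡n⇒m≤n (6 * k + 2) (solve (k ∷ []))) (m+o≡n⇒m≤n 2 (solve (k ∷ []))) (solve (k ∷ []))
...   | suc (suc (suc e)) , refl = ⊥-elim (<⇒≱ 2w<a (m+o≡n⇒m≤n (1 + 2 * e) (solve (k ∷ e ∷ []))))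

conductor-odd : ∀ k w → 1 + 2 * w < 6 * k + 5 → G k ((4 * k + 1) * (6 * k + 5) + 3 + (1 + 2 * w))
conductor-odd k w 2w+1<a with w <? 3 * k + 1
... | yes w<3k+1 with e , h ← m≤n⇒∃[o]m+o≡n w<3k+1 =
  dip∈G k (2 * k + 1) 1 (3 + 3 * k + e) _ (m≤m+n 2 _)
    (m+o≡n⇒m≤n w (begin
      3 + 3 * k + e + w        ≡⟨ solve (k ∷ e ∷ w ∷ []) ⟩
      3 * k + 2 + (suc w + e)  ≡⟨ cong (3 * k + 2 +_) h ⟩
      3 * k + 2 + (3 * k + 1)  ≡⟨ solve (k ∷ []) ⟩
      3 * (2 * k + 1)          ∎))
    (begin
      (4 * k + 1) * (6 * k + 5) + 3 + (1 + 2 * w) + 2 * (3 + 3 * k + e)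
        ≡⟨ solve (k ∷ w ∷ e ∷ []) ⟩
      (4 * k + 1) * (6 * k + 5) + 8 + 6 * k + 2 * (suc w + e)
        ≡⟨ cong (λ z → (4 * k + 1) * (6 * k + 5) + 8 + 6 * k + 2 * z) h ⟩
      (4 * k + 1) * (6 * k + 5) + 8 + 6 * k + 2 * (3 * k + 1)
        ≡⟨ solve (k ∷ []) ⟩
      (2 * (2 * k + 1) + 1) * (6 * k + 5) ∎)
... | no w≮3k+1 with m≤n⇒∃[o]m+o≡n (≮⇒≥ w≮3k+1)
...   | 0 , refl = dip∈G k (2 * k + 1) 1 (3 * k + 2) ((4 * k + 1) * (6 * k + 5) + 3 + (1 + 2 * (3 * k + 1 + 0)))
  (m+o≡n⇒m≤n (3 * k) (solve (k ∷ []))) (m+o≡n⇒m≤n (3 * k + 1) (solve (k ∷ []))) (solve (k ∷ []))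
...   | suc e , refl = ⊥-elim (<⇒≱ 2w+1<a (m+o≡n⇒m≤n (2 * e) (solve (k ∷ e ∷ []))))

conductor-window : ∀ k y → y < 6 * k + 5 → G k ((4 * k + 1) * (6 * k + 5) + 3 + y)
conductor-window k y y<a with even⊎odd y
... | w , inj₁ refl = conductor-even k w y<a
... | w , inj₂ refl = conductor-odd k w y<a

conductor≤⇒∈G : ∀ k x → (4 * k + 1) * (6 * k + 5) + 3 ≤ x → G k x
conductor≤⇒∈G k x F≤x with y , refl ← m≤n⇒∃[o]m+o≡n F≤x =
  G-resp k (trans (+-assoc F _ _) (cong (F +_) (sym (m≡m%n+[m/n]*n y (6 * k + 5)))))
    (gen-+ (conductor-window k (y % (6 * k + 5)) (m%n<n y (6 * k + 5)))
           (*-closed k (y / (6 * k + 5)) (a∈G k)))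
  where
  F = (4 * k + 1) * (6 * k + 5) + 3
  instance
    a-nonZero : NonZero (6 * k + 5)
    a-nonZero = subst NonZero (+-comm 5 (6 * k)) _

-- The nonzero elements of ⟨ S₃ k ⟩ in increasing order are cut into windows with lengths divisible
-- by 3.  The window Iε m d (m + d + 1 = k) or IIε μ ν (μ + ν + ε = k) lies next to the point
-- (2M + ε + 1) a, where M = m resp. M = k + μ.  Type-I windows lie where consecutive layers do not
-- overlap: the point, then the dips of layer 2M + ε + 2.  In type-II windows the layers overlap and
-- past offset 2 + 3ν the gaps drop from 2 to 1.  II₀ k 0 is the infinite tail.
data Window : Set where
  I₀ I₁ II₀ II₁ : ℕ → ℕ → Window

offset : ℕ → ℕ → ℕ
offset zero    i       = i
offset (suc c) zero    = 1
offset (suc c) (suc i) = 2 + offset c i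

valueI : ℕ → ℕ → ℕ → ℕ → ℕ
valueI k P d zero    = P + (6 * k + 5)
valueI k P d (suc i) = P + (6 * k + 5) + 6 * d + 5 + 2 * i

valueII : ℕ → ℕ → ℕ → ℕ → ℕ
valueII k P ν zero          = P + (6 * k + 4)
valueII k P ν (suc zero)    = P + (6 * k + 5)
valueII k P ν (suc (suc i)) = P + (6 * k + 5) + offset (2 + 3 * ν) i

value : ℕ → Window → ℕ → ℕ
value k (I₀ m d)  = valueI k ((2 * m + 0) * (6 * k + 5)) d
value k (I₁ m d)  = valueI k ((2 * m + 1) * (6 * k + 5)) d
value k (II₀ μ ν) = valueII k ((2 * (k + μ) + 0) * (6 * k + 5)) ν
value k (II₁ μ ν) = valueII k ((2 * (k + μ) + 1) * (6 * k + 5)) ν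

length : ℕ → Window → ℕ
length k (I₀ m d)  = 3 + 3 * m
length k (I₁ m d)  = 3 + 3 * m
length k (II₀ μ ν) = 3 + 3 * (k + μ)
length k (II₁ μ ν) = 6 + 3 * (k + μ)

next : ℕ → Window → Window
next k (I₀ m d)        = I₁ m d
next k (I₁ m (suc d))  = I₀ (suc m) d
next k (I₁ m zero)     = II₀ 0 k
next k (II₀ μ (suc ν)) = II₁ μ ν
next k (II₀ μ zero)    = II₀ μ zero   -- junk: the tail is never left
next k (II₁ μ ν)       = II₀ (suc μ) ν

isTail : Window → Bool
isTail (II₀ μ zero) = true
isTail _            = false

State : Set
State = Window × ℕ

advance : ℕ → Window → ℕ → Bool → State
advance k w i true  = w , suc i
advance k w i false = next k w , 0

step : ℕ → State → State
step k (w , i) = advance k w i (isTail w ∨ (suc i <ᵇ length k w))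

state : ℕ → ℕ → State
state k zero    = I₀ 0 (pred k) , 0
state k (suc n) = step k (state k n)

enumerate : ℕ → ℕ → ℕ
enumerate k zero    = 0
enumerate k (suc n) = uncurry (value k) (state k n)

ValidWindow : ℕ → Window → Set
ValidWindow k (I₀ m d)  = k ≡ suc (m + d)
ValidWindow k (I₁ m d)  = k ≡ suc (m + d)
ValidWindow k (II₀ μ ν) = k ≡ μ + ν
ValidWindow k (II₁ μ ν) = k ≡ μ + suc ν

InWindow : ℕ → Window → ℕ → Set
InWindow k w i = i < length k w ⊎ isTail w ≡ true

Valid : ℕ → State → Set
Valid k (w , i) = ValidWindow k w × InWindow k w i

n<ᵇn≡false : ∀ n → (n <ᵇ n) ≡ false
n<ᵇn≡false zero    = refl
n<ᵇn≡false (suc n) = n<ᵇn≡false n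

step-inside : ∀ k w i → suc i < length k w → step k (w , i) ≡ (w , suc i)
step-inside k w i i+1<len
  rewrite Equivalence.to T-≡ (<⇒<ᵇ i+1<len) | ∨-zeroʳ (isTail w) = refl

step-tail : ∀ k w i → isTail w ≡ true → step k (w , i) ≡ (w , suc i)
step-tail k w i tail rewrite tail = refl

step-last : ∀ k w i → isTail w ≡ false → suc i ≡ length k w → step k (w , i) ≡ (next k w , 0)
step-last k w i finite last rewrite finite | sym last | n<ᵇn≡false (suc i) = refl

step-within : ∀ k w i → InWindow k w (suc i) → step k (w , i) ≡ (w , suc i)
step-within k w i (inj₁ i+1<len) = step-inside k w i i+1<len
step-within k w i (inj₂ tail)    = step-tail k w i tail

last-index : ∀ k w → ∃ λ j → suc j ≡ length k w
last-index k (I₀ _ _)  = _ , refl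
last-index k (I₁ _ _)  = _ , refl
last-index k (II₀ _ _) = _ , refl
last-index k (II₁ _ _) = _ , refl

length≡3* : ∀ k w → ∃ λ l → length k w ≡ 3 * l
length≡3* k (I₀ m d)  = suc m , sym (*-suc 3 m)
length≡3* k (I₁ m d)  = suc m , sym (*-suc 3 m)
length≡3* k (II₀ μ ν) = suc (k + μ) , sym (*-suc 3 (k + μ))
length≡3* k (II₁ μ ν) = 2 + (k + μ) , sym (trans (*-suc 3 (suc (k + μ))) (cong (3 +_) (*-suc 3 (k + μ))))

next-valid : ∀ k w → ValidWindow k w → isTail w ≡ false → ValidWindow k (next k w)
next-valid k (I₀ m d)        v _ = v
next-valid k (I₁ m (suc d))  v _ = trans v (cong suc (+-suc m d))
next-valid k (I₁ m zero)     v _ = refl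
next-valid k (II₀ μ (suc ν)) v _ = v
next-valid k (II₁ μ ν)       v _ = trans v (+-suc μ ν)

data StepCase (k : ℕ) (w : Window) (i : ℕ) : Set where
  within : step k (w , i) ≡ (w , suc i) → InWindow k w (suc i) → StepCase k w i
  leave  : step k (w , i) ≡ (next k w , 0) → isTail w ≡ false → suc i ≡ length k w →
           StepCase k w i

step-cases : ∀ k w i → InWindow k w i → StepCase k w i
step-cases k w i (inj₂ tail) = within (step-tail k w i tail) (inj₂ tail)
step-cases k w i (inj₁ i<len) with isTail w in tail?
... | true  = within (step-tail k w i tail?) (inj₂ tail?)
... | false with m≤n⇒m<n∨m≡n i<len
...   | inj₁ i+1<len = within (step-inside k w i i+1<len) (inj₁ i+1<len)
...   | inj₂ last    = leave (step-last k w i tail? last) tail? last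

step-valid : ∀ k σ → Valid k σ → Valid k (step k σ)
step-valid k (w , i) (v , inw) with step-cases k w i inw
... | within eq inw′       rewrite eq = v , inw′
... | leave eq finite last rewrite eq =
  next-valid k w v finite , inj₁ (subst (0 <_) (proj₂ (last-index k (next k w))) z<s)

state-valid : ∀ k → 1 ≤ k → ∀ n → Valid k (state k n)
state-valid (suc k) _ zero = refl , inj₁ z<s
state-valid k 1≤k (suc n) = step-valid k (state k n) (state-valid k 1≤k n)

state-aligned : ∀ k → 1 ≤ k → ∀ n → ∃ λ c → n ≡ 3 * c + proj₂ (state k n)
state-aligned k 1≤k zero = 0 , refl
state-aligned k 1≤k (suc n) with state k n | state-valid k 1≤k n | state-aligned k 1≤k n
... | w , i | _ , inw | c , n≡ with step-cases k w i inw
...   | within eq _ rewrite eq = c , trans (cong suc n≡) (sym (+-suc (3 * c) i))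
...   | leave eq _ last rewrite eq with l , len≡ ← length≡3* k w = c + l , (begin
  suc n               ≡⟨ cong suc n≡ ⟩
  suc (3 * c + i)     ≡⟨ +-suc (3 * c) i ⟨
  3 * c + suc i       ≡⟨ cong (3 * c +_) (trans last len≡) ⟩
  3 * c + 3 * l       ≡⟨ solve (c ∷ l ∷ []) ⟩
  3 * (c + l) + 0     ∎)

Reachable : ℕ → State → Set
Reachable k σ = ∃ λ n → state k n ≡ σ

reachable-within : ∀ k w → Reachable k (w , 0) → ∀ i → InWindow k w i → Reachable k (w , i)
reachable-within k w r zero    _   = r
reachable-within k w r (suc i) inw
  with n , eq ← reachable-within k w r i (Data.Sum.map₁ <⇒≤ inw) =
  suc n , trans (cong (step k) eq) (step-within k w i inw)

reachable-next : ∀ k w → isTail w ≡ false → Reachable k (w , 0) → Reachable k (next k w , 0)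
reachable-next k w finite r
  with j , last ← last-index k w
  with n , eq ← reachable-within k w r j (inj₁ (≤-reflexive last)) =
  suc n , trans (cong (step k) eq) (step-last k w j finite last)

reachable-I : ∀ k m d → k ≡ m + d →
  Reachable (suc k) (I₀ m d , 0) × Reachable (suc k) (I₁ m d , 0)
reachable-I k zero d refl = (0 , refl) , reachable-next (suc k) (I₀ 0 k) refl (0 , refl)
reachable-I k (suc m) d k≡ with _ , r₁ ← reachable-I k m (suc d) (trans k≡ (sym (+-suc m d))) =
  r₀ , reachable-next (suc k) (I₀ (suc m) d) refl r₀
  where r₀ = reachable-next (suc k) (I₁ m (suc d)) refl r₁

reachable-II₀ : ∀ k μ ν → suc k ≡ μ + ν → Reachable (suc k) (II₀ μ ν , 0)
reachable-II₁ : ∀ k μ ν → suc k ≡ μ + suc ν → Reachable (suc k) (II₁ μ ν , 0)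
reachable-II₀ k zero ν refl =
  reachable-next (suc k) (I₁ k 0) refl (proj₂ (reachable-I k k 0 (sym (+-identityʳ k))))
reachable-II₀ k (suc μ) ν k≡ =
  reachable-next (suc k) (II₁ μ ν) refl (reachable-II₁ k μ ν (trans k≡ (sym (+-suc μ ν))))
reachable-II₁ k μ ν k≡ = reachable-next (suc k) (II₀ μ (suc ν)) refl (reachable-II₀ k μ (suc ν) k≡)

valid⇒reachable : ∀ k σ → Valid (suc k) σ → Reachable (suc k) σ
valid⇒reachable k (w , i) (v , inw) = reachable-within (suc k) w (start w v) i inw
  where
  start : ∀ w → ValidWindow (suc k) w → Reachable (suc k) (w , 0)
  start (I₀ m d)  v = proj₁ (reachable-I k m d (suc-injective v))
  start (I₁ m d)  v = proj₂ (reachable-I k m d (suc-injective v))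
  start (II₀ μ ν) v = reachable-II₀ k μ ν v
  start (II₁ μ ν) v = reachable-II₁ k μ ν v

offset-increasing : ∀ c i → offset c i < offset c (suc i)
offset-increasing zero          i       = ≤-refl
offset-increasing (suc zero)    zero    = s≤s (s≤s z≤n)
offset-increasing (suc (suc c)) zero    = s≤s (s≤s z≤n)
offset-increasing (suc c)       (suc i) = s≤s (s≤s (offset-increasing c i))

offset≤ : ∀ c i → offset c i ≤ c + i
offset≤ zero    i       = ≤-refl
offset≤ (suc c) zero    = s≤s z≤n
offset≤ (suc c) (suc i) = s≤s (subst (suc (offset c i) ≤_) (sym (+-suc c i)) (s≤s (offset≤ c i)))

offset-below : ∀ c j → j < c → offset c j ≡ 1 + 2 * j
offset-below (suc c) zero    _         = refl
offset-below (suc c) (suc j) (s≤s j<c) = trans (cong (2 +_) (offset-below c j j<c)) (solve (j ∷ []))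

offset-above : ∀ c l → offset c (c + l) ≡ 2 * c + l
offset-above zero    l = refl
offset-above (suc c) l = trans (cong (2 +_) (offset-above c l)) (solve (c ∷ l ∷ []))

value-within-increasing : ∀ k w i → value k w i < value k w (suc i)
value-within-increasing k w i = go w i
  where
  I-increasing : ∀ P d i → valueI k P d i < valueI k P d (suc i)
  I-increasing P d zero    = m+o≡n⇒m≤n (6 * d + 4) eq
    where eq : suc (P + (6 * k + 5)) + (6 * d + 4) ≡ P + (6 * k + 5) + 6 * d + 5 + 2 * 0
          eq = solve (P ∷ k ∷ d ∷ [])
  I-increasing P d (suc i) = m+o≡n⇒m≤n 1 eq
    where eq : suc (P + (6 * k + 5) + 6 * d + 5 + 2 * i) + 1 ≡ P + (6 * k + 5) + 6 * d + 5 + 2 * suc i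
          eq = solve (P ∷ k ∷ d ∷ i ∷ [])
  II-increasing : ∀ P ν i → valueII k P ν i < valueII k P ν (suc i)
  II-increasing P ν zero          = m+o≡n⇒m≤n 0 eq
    where eq : suc (P + (6 * k + 4)) + 0 ≡ P + (6 * k + 5)
          eq = solve (P ∷ k ∷ [])
  II-increasing P ν (suc zero)    = m+o≡n⇒m≤n 0 eq
    where eq : suc (P + (6 * k + 5)) + 0 ≡ P + (6 * k + 5) + 1
          eq = solve (P ∷ k ∷ [])
  II-increasing P ν (suc (suc i)) = +-monoʳ-< (P + (6 * k + 5)) (offset-increasing (2 + 3 * ν) i)
  go : ∀ w i → value k w i < value k w (suc i)
  go (I₀ m d)  = I-increasing _ d
  go (I₁ m d)  = I-increasing _ d
  go (II₀ μ ν) = II-increasing _ ν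
  go (II₁ μ ν) = II-increasing _ ν

value-leave-increasing : ∀ k w i → ValidWindow k w → isTail w ≡ false → suc i ≡ length k w →
                         value k w i < value k (next k w) 0
value-leave-increasing _ (I₀ m d) i refl _ refl = m+o≡n⇒m≤n 3 eq
  where
  eq : suc ((2 * m + 0) * (6 * suc (m + d) + 5) + (6 * suc (m + d) + 5) + 6 * d + 5 + 2 * (1 + 3 * m)) + 3
     ≡ (2 * m + 1) * (6 * suc (m + d) + 5) + (6 * suc (m + d) + 5)
  eq = solve (m ∷ d ∷ [])
value-leave-increasing _ (I₁ m (suc d)) i refl _ refl = m+o≡n⇒m≤n 3 eq
  where
  eq : suc ((2 * m + 1) * (6 * suc (m + suc d) + 5) + (6 * suc (m + suc d) + 5) + 6 * suc d + 5 + 2 * (1 + 3 * m)) + 3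
     ≡ (2 * suc m + 0) * (6 * suc (m + suc d) + 5) + (6 * suc (m + suc d) + 5)
  eq = solve (m ∷ d ∷ [])
value-leave-increasing _ (I₁ m zero) i refl _ refl = m+o≡n⇒m≤n 2 eq
  where
  eq : suc ((2 * m + 1) * (6 * suc (m + 0) + 5) + (6 * suc (m + 0) + 5) + 6 * 0 + 5 + 2 * (1 + 3 * m)) + 2
     ≡ (2 * (suc (m + 0) + 0) + 0) * (6 * suc (m + 0) + 5) + (6 * suc (m + 0) + 4)
  eq = solve (m ∷ [])
value-leave-increasing _ (II₀ μ (suc ν)) i refl _ refl =
  ≤-<-trans (+-monoʳ-≤ _ (offset≤ (2 + 3 * suc ν) (3 * ((μ + suc ν) + μ)))) (m+o≡n⇒m≤n 1 eq)
  where
  eq : suc ((2 * ((μ + suc ν) + μ) + 0) * (6 * (μ + suc ν) + 5) + (6 * (μ + suc ν) + 5)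
             + (2 + 3 * suc ν + 3 * ((μ + suc ν) + μ))) + 1
     ≡ (2 * ((μ + suc ν) + μ) + 1) * (6 * (μ + suc ν) + 5) + (6 * (μ + suc ν) + 4)
  eq = solve (μ ∷ ν ∷ [])
value-leave-increasing _ (II₁ μ ν) i refl _ refl =
  ≤-<-trans (+-monoʳ-≤ _ (offset≤ (2 + 3 * ν) (3 + 3 * ((μ + suc ν) + μ)))) (m+o≡n⇒m≤n 1 eq)
  where
  eq : suc ((2 * ((μ + suc ν) + μ) + 1) * (6 * (μ + suc ν) + 5) + (6 * (μ + suc ν) + 5)
             + (2 + 3 * ν + (3 + 3 * ((μ + suc ν) + μ)))) + 1
     ≡ (2 * ((μ + suc ν) + suc μ) + 0) * (6 * (μ + suc ν) + 5) + (6 * (μ + suc ν) + 4)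
  eq = solve (μ ∷ ν ∷ [])

step-increasing : ∀ k σ → Valid k σ → uncurry (value k) σ < uncurry (value k) (step k σ)
step-increasing k (w , i) (v , inw) with step-cases k w i inw
... | within eq _          rewrite eq = value-within-increasing k w i
... | leave eq finite last rewrite eq = value-leave-increasing k w i v finite last

enumerate-increasing : ∀ k → 1 ≤ k → ∀ n → enumerate k n < enumerate k (suc n)
enumerate-increasing (suc k) _   zero    = z<s
enumerate-increasing k       1≤k (suc n) = step-increasing k (state k n) (state-valid k 1≤k n)

head-dip : ∀ k M ε →
  (2 * M + ε) * (6 * k + 5) + (6 * k + 4) + 2 * (3 * k + 3) ≡ (2 * suc M + ε) * (6 * k + 5)
head-dip k M ε = solve (k ∷ M ∷ ε ∷ [])

run-dip : ∀ k M ε j e → j + e ≡ 3 * k →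
  (2 * M + ε) * (6 * k + 5) + (6 * k + 5) + (1 + 2 * j) + 2 * (2 + e) ≡ (2 * suc M + ε) * (6 * k + 5)
run-dip k M ε j e j+e≡3k = begin
  (2 * M + ε) * (6 * k + 5) + (6 * k + 5) + (1 + 2 * j) + 2 * (2 + e)
    ≡⟨ solve (M ∷ ε ∷ k ∷ j ∷ e ∷ []) ⟩
  (2 * M + ε) * (6 * k + 5) + (6 * k + 5) + 5 + 2 * (j + e)
    ≡⟨ cong (λ z → (2 * M + ε) * (6 * k + 5) + (6 * k + 5) + 5 + 2 * z) j+e≡3k ⟩
  (2 * M + ε) * (6 * k + 5) + (6 * k + 5) + 5 + 2 * (3 * k)
    ≡⟨ solve (M ∷ ε ∷ k ∷ []) ⟩
  (2 * suc M + ε) * (6 * k + 5) ∎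

odd-dip : ∀ k M ε σ ν w e → σ + ν ≡ k → w + (2 + e) ≡ 3 * σ →
  (2 * M + ε) * (6 * k + 5) + (6 * k + 5) + (2 * (2 + 3 * ν) + (1 + 2 * w)) + 2 * (2 + e)
  ≡ (2 * suc M + ε) * (6 * k + 5)
odd-dip k M ε σ ν w e σ+ν≡k w+t≡3σ = begin
  (2 * M + ε) * (6 * k + 5) + (6 * k + 5) + (2 * (2 + 3 * ν) + (1 + 2 * w)) + 2 * (2 + e)
    ≡⟨ solve (M ∷ ε ∷ k ∷ ν ∷ w ∷ e ∷ []) ⟩
  (2 * M + ε) * (6 * k + 5) + (6 * k + 5) + 5 + 6 * ν + 2 * (w + (2 + e))
    ≡⟨ cong (λ z → (2 * M + ε) * (6 * k + 5) + (6 * k + 5) + 5 + 6 * ν + 2 * z) w+t≡3σ ⟩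
  (2 * M + ε) * (6 * k + 5) + (6 * k + 5) + 5 + 6 * ν + 2 * (3 * σ)
    ≡⟨ solve (M ∷ ε ∷ k ∷ ν ∷ σ ∷ []) ⟩
  (2 * M + ε) * (6 * k + 5) + (6 * k + 5) + 5 + 6 * (σ + ν)
    ≡⟨ cong (λ z → (2 * M + ε) * (6 * k + 5) + (6 * k + 5) + 5 + 6 * z) σ+ν≡k ⟩
  (2 * M + ε) * (6 * k + 5) + (6 * k + 5) + 5 + 6 * k
    ≡⟨ solve (M ∷ ε ∷ k ∷ []) ⟩
  (2 * suc M + ε) * (6 * k + 5) ∎

even-dip : ∀ k M ε σ ν w e → σ + ν ≡ k → suc w + e ≡ 3 * σ →
  (2 * M + ε) * (6 * k + 5) + (6 * k + 5) + (2 * (2 + 3 * ν) + 2 * w) + 2 * (3 * k + 4 + e)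
  ≡ (2 * M + ε + 3) * (6 * k + 5)
even-dip k M ε σ ν w e σ+ν≡k w+e≡3σ = begin
  (2 * M + ε) * (6 * k + 5) + (6 * k + 5) + (2 * (2 + 3 * ν) + 2 * w) + 2 * (3 * k + 4 + e)
    ≡⟨ solve (M ∷ ε ∷ k ∷ ν ∷ w ∷ e ∷ []) ⟩
  (2 * M + ε) * (6 * k + 5) + (6 * k + 5) + 10 + 6 * ν + 6 * k + 2 * (suc w + e)
    ≡⟨ cong (λ z → (2 * M + ε) * (6 * k + 5) + (6 * k + 5) + 10 + 6 * ν + 6 * k + 2 * z) w+e≡3σ ⟩
  (2 * M + ε) * (6 * k + 5) + (6 * k + 5) + 10 + 6 * ν + 6 * k + 2 * (3 * σ)
    ≡⟨ solve (M ∷ ε ∷ k ∷ ν ∷ σ ∷ []) ⟩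
  (2 * M + ε) * (6 * k + 5) + (6 * k + 5) + 10 + 6 * k + 6 * (σ + ν)
    ≡⟨ cong (λ z → (2 * M + ε) * (6 * k + 5) + (6 * k + 5) + 10 + 6 * k + 6 * z) σ+ν≡k ⟩
  (2 * M + ε) * (6 * k + 5) + (6 * k + 5) + 10 + 6 * k + 6 * k
    ≡⟨ solve (M ∷ ε ∷ k ∷ []) ⟩
  (2 * M + ε + 3) * (6 * k + 5) ∎

valueI-run : ∀ k P d i → valueI k P d (suc i) ≡ P + (6 * k + 5) + (1 + 2 * (3 * d + 2 + i))
valueI-run k P d i = begin
  P + (6 * k + 5) + 6 * d + 5 + 2 * i           ≡⟨ solve (P ∷ k ∷ d ∷ i ∷ []) ⟩
  P + (6 * k + 5) + (1 + 2 * (3 * d + 2 + i))   ∎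

valueII-below : ∀ k P ν j → j < 2 + 3 * ν →
                valueII k P ν (2 + j) ≡ P + (6 * k + 5) + (1 + 2 * j)
valueII-below k P ν j j<c = cong (P + (6 * k + 5) +_) (offset-below (2 + 3 * ν) j j<c)

valueII-above : ∀ k P ν l → valueII k P ν (2 + (2 + 3 * ν + l)) ≡ P + (6 * k + 5) + (2 * (2 + 3 * ν) + l)
valueII-above k P ν l = cong (P + (6 * k + 5) +_) (offset-above (2 + 3 * ν) l)

≤3*suc : ∀ {m n} → m ≤ 3 + 3 * n → m ≤ 3 * suc n
≤3*suc {m} {n} = subst (m ≤_) (sym (*-suc 3 n))

run∈G : ∀ k M ε j e x → j + e ≡ 3 * k → e ≤ 1 + 3 * M →
        x ≡ (2 * M + ε) * (6 * k + 5) + (6 * k + 5) + (1 + 2 * j) → G k x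
run∈G k M ε j e x j+e≡3k e≤1+3M x≡ =
  dip∈G k (suc M) ε (2 + e) x (m≤m+n 2 e) (≤3*suc (+-monoʳ-≤ 2 e≤1+3M))
    (trans (cong (_+ 2 * (2 + e)) x≡) (run-dip k M ε j e j+e≡3k))

I-run-index : ∀ m d i e → i + e ≡ 1 + 3 * m → 3 * d + 2 + i + e ≡ 3 * suc (m + d)
I-run-index m d i e i+e≡ = begin
  3 * d + 2 + i + e       ≡⟨ +-assoc (3 * d + 2) i e ⟩
  3 * d + 2 + (i + e)     ≡⟨ cong (3 * d + 2 +_) i+e≡ ⟩
  3 * d + 2 + (1 + 3 * m) ≡⟨ solve (d ∷ m ∷ []) ⟩
  3 * suc (m + d)         ∎

I∈G : ∀ m d ε i → i < 3 + 3 * m →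
      G (suc (m + d)) (valueI (suc (m + d)) ((2 * m + ε) * (6 * suc (m + d) + 5)) d i)
I∈G m d ε zero _ = G-resp (suc (m + d)) eq (*-closed (suc (m + d)) (2 * m + ε + 1) (a∈G (suc (m + d))))
  where eq : (2 * m + ε + 1) * (6 * suc (m + d) + 5)
           ≡ (2 * m + ε) * (6 * suc (m + d) + 5) + (6 * suc (m + d) + 5)
        eq = solve (m ∷ d ∷ ε ∷ [])
I∈G m d ε (suc i) i<len with e , i+e≡ ← m≤n⇒∃[o]m+o≡n (s≤s⁻¹ (s≤s⁻¹ i<len)) =
  run∈G (suc (m + d)) m ε (3 * d + 2 + i) e _ (I-run-index m d i e i+e≡)
    (m+o≡n⇒m≤n i (trans (+-comm e i) i+e≡)) (valueI-run (suc (m + d)) _ d i)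

II-head∈G : ∀ k M ε ν i → k ≤ M → i < 2 → G k (valueII k ((2 * M + ε) * (6 * k + 5)) ν i)
II-head∈G k M ε ν zero k≤M _ =
  dip∈G k (suc M) ε (3 * k + 3) _ (≤-trans (s≤s (s≤s z≤n)) (m≤n+m 3 (3 * k)))
    (≤3*suc (subst (_≤ 3 + 3 * M) (+-comm 3 (3 * k)) (+-monoʳ-≤ 3 (*-monoʳ-≤ 3 k≤M)))) (head-dip k M ε)
II-head∈G k M ε ν (suc zero) _ _ = G-resp k eq (*-closed k (2 * M + ε + 1) (a∈G k))
  where
  eq : (2 * M + ε + 1) * (6 * k + 5) ≡ (2 * M + ε) * (6 * k + 5) + (6 * k + 5)
  eq = solve (M ∷ ε ∷ k ∷ [])
II-head∈G k M ε ν (suc (suc i)) _ (s≤s (s≤s ()))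

halve-even : ∀ w s → 2 + 2 * w ≤ 6 * s → ∃ λ e → suc w + e ≡ 3 * s
halve-even w s bound = m≤n⇒∃[o]m+o≡n (*-cancelˡ-≤ {suc w} {3 * s} 2 (subst₂ _≤_ eq₁ eq₂ bound))
  where
  eq₁ : 2 + 2 * w ≡ 2 * suc w
  eq₁ = solve (w ∷ [])
  eq₂ : 6 * s ≡ 2 * (3 * s)
  eq₂ = solve (s ∷ [])

halve-odd : ∀ w s → 3 + 2 * w ≤ 6 * s → ∃ λ e → w + (2 + e) ≡ 3 * s
halve-odd w s bound =
  Data.Product.map₂ (λ {e} eq → trans (+-suc w (1 + e)) (trans (cong suc (+-suc w e)) eq))
       (m≤n⇒∃[o]m+o≡n (*-cancelˡ-< 2 (suc w) (3 * s) (subst₂ _≤_ eq₁ eq₂ bound)))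
  where
  eq₁ : 3 + 2 * w ≡ suc (2 * suc w)
  eq₁ = solve (w ∷ [])
  eq₂ : 6 * s ≡ 2 * (3 * s)
  eq₂ = solve (s ∷ [])

mixed-odd∈G : ∀ k M ε σ ν w e x → σ + ν ≡ k → σ ≤ suc M → w + (2 + e) ≡ 3 * σ →
  x ≡ (2 * M + ε) * (6 * k + 5) + (6 * k + 5) + (2 * (2 + 3 * ν) + (1 + 2 * w)) → G k x
mixed-odd∈G k M ε σ ν w e x σ+ν≡k σ≤M+1 w+t≡3σ x≡ =
  dip∈G k (suc M) ε (2 + e) x (m≤m+n 2 e)
    (≤-trans (m+n≤o⇒n≤o w (≤-reflexive w+t≡3σ)) (*-monoʳ-≤ 3 σ≤M+1))
    (trans (cong (_+ 2 * (2 + e)) x≡) (odd-dip k M ε σ ν w e σ+ν≡k w+t≡3σ))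

mixed-even∈G : ∀ k M ε M′ ε′ σ ν w e x → σ + ν ≡ k → 2 * M′ + ε′ ≡ 2 * M + ε + 3 →
  k + σ + 1 ≤ M′ → suc w + e ≡ 3 * σ →
  x ≡ (2 * M + ε) * (6 * k + 5) + (6 * k + 5) + (2 * (2 + 3 * ν) + 2 * w) → G k x
mixed-even∈G k M ε M′ ε′ σ ν w e x σ+ν≡k layer≡ k+σ+1≤M′ w+e≡3σ x≡ =
  dip∈G k M′ ε′ (3 * k + 4 + e) x (m+o≡n⇒m≤n (3 * k + 2 + e) (solve (k ∷ e ∷ []))) t≤3M′
    (trans (cong (_+ 2 * (3 * k + 4 + e)) x≡)
           (trans (even-dip k M ε σ ν w e σ+ν≡k w+e≡3σ) (cong (_* (6 * k + 5)) (sym layer≡))))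
  where
  t≤3M′ : 3 * k + 4 + e ≤ 3 * M′
  t≤3M′ = ≤-trans (m+o≡n⇒m≤n w (begin
    3 * k + 4 + e + w        ≡⟨ solve (k ∷ e ∷ w ∷ []) ⟩
    3 * k + 3 + (suc w + e)  ≡⟨ cong (3 * k + 3 +_) w+e≡3σ ⟩
    3 * k + 3 + 3 * σ        ≡⟨ solve (k ∷ σ ∷ []) ⟩
    3 * (k + σ + 1)          ∎)) (*-monoʳ-≤ 3 k+σ+1≤M′)

run-slack : ∀ {j e k} M → j + e ≡ 3 * k → k ≤ M → e ≤ 1 + 3 * M
run-slack {j} M j+e≡3k k≤M =
  ≤-trans (m+n≤o⇒n≤o j (≤-reflexive j+e≡3k)) (≤-trans (*-monoʳ-≤ 3 k≤M) (n≤1+n _))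

II₀-run-bound : ∀ μ ν j → 1 ≤ μ + ν → j < 2 + 3 * ν → InWindow (μ + ν) (II₀ μ ν) (2 + j) →
                j ≤ 3 * (μ + ν)
II₀-run-bound zero    ν       j _ _ (inj₁ j<len) =
  subst (λ n → j ≤ 3 * n) (+-identityʳ ν) (s≤s⁻¹ (s≤s⁻¹ (s≤s⁻¹ j<len)))
II₀-run-bound zero    (suc ν) j _ _ (inj₂ ())
II₀-run-bound (suc μ) ν       j _ j<c _ = ≤-trans (s≤s⁻¹ j<c) (m+o≡n⇒m≤n (2 + 3 * μ) eq)
  where eq : 1 + 3 * ν + (2 + 3 * μ) ≡ 3 * (suc μ + ν)
        eq = solve (ν ∷ μ ∷ [])

II₀-mixed-bound : ∀ μ ν l → 3 + (2 + 3 * suc ν + l) ≤ 3 + 3 * (μ + suc ν + μ) → 2 + l ≤ 6 * μ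
II₀-mixed-bound μ ν l i<len =
  +-cancelˡ-≤ (3 * suc ν) _ _ (subst₂ _≤_ eq₁ eq₂ (s≤s⁻¹ (s≤s⁻¹ (s≤s⁻¹ i<len))))
  where eq₁ : 2 + 3 * suc ν + l ≡ 3 * suc ν + (2 + l)
        eq₁ = solve (ν ∷ l ∷ [])
        eq₂ : 3 * (μ + suc ν + μ) ≡ 3 * suc ν + 6 * μ
        eq₂ = solve (μ ∷ ν ∷ [])

II₀∈G : ∀ μ ν i → 1 ≤ μ + ν → InWindow (μ + ν) (II₀ μ ν) i → G (μ + ν) (value (μ + ν) (II₀ μ ν) i)
II₀∈G μ ν zero          _   _ = II-head∈G (μ + ν) (μ + ν + μ) 0 ν 0 (m≤m+n _ μ) z<s
II₀∈G μ ν (suc zero)    _   _ = II-head∈G (μ + ν) (μ + ν + μ) 0 ν 1 (m≤m+n _ μ) (s≤s z<s)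
II₀∈G μ ν (suc (suc j)) 1≤k inw with j <? 2 + 3 * ν
... | yes j<c with e , j+e≡3k ← m≤n⇒∃[o]m+o≡n (II₀-run-bound μ ν j 1≤k j<c inw) =
  run∈G (μ + ν) (μ + ν + μ) 0 j e _ j+e≡3k (run-slack (μ + ν + μ) j+e≡3k (m≤m+n _ μ))
    (valueII-below (μ + ν) ((2 * (μ + ν + μ) + 0) * (6 * (μ + ν) + 5)) ν j j<c)
... | no j≮c with l , refl ← m≤n⇒∃[o]m+o≡n (≮⇒≥ j≮c) = mixed ν inw
  where
  mixed : ∀ ν → InWindow (μ + ν) (II₀ μ ν) (2 + (2 + 3 * ν + l)) →
          G (μ + ν) (value (μ + ν) (II₀ μ ν) (2 + (2 + 3 * ν + l)))
  mixed zero _ = conductor≤⇒∈G (μ + 0) _ (m+o≡n⇒m≤n (1 + l) (begin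
    (4 * (μ + 0) + 1) * (6 * (μ + 0) + 5) + 3 + (1 + l)
      ≡⟨ solve (μ ∷ l ∷ []) ⟩
    (2 * (μ + 0 + μ) + 0) * (6 * (μ + 0) + 5) + (6 * (μ + 0) + 5) + (2 * (2 + 3 * 0) + l)
      ≡⟨ valueII-above (μ + 0) ((2 * (μ + 0 + μ) + 0) * (6 * (μ + 0) + 5)) 0 l ⟨
    value (μ + 0) (II₀ μ 0) (2 + (2 + 3 * 0 + l)) ∎))
  mixed (suc ν) (inj₂ ())
  mixed (suc ν) (inj₁ i<len) with even⊎odd l | II₀-mixed-bound μ ν l i<len
  ... | w , inj₁ refl | bound with e , w+e≡3μ ← halve-even w μ bound =
    mixed-even∈G (μ + suc ν) (μ + suc ν + μ) 0 (suc (μ + suc ν + μ)) 1 μ (suc ν) w e _ refl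
      (solve (μ ∷ ν ∷ [])) (≤-reflexive (+-comm _ 1)) w+e≡3μ
      (valueII-above (μ + suc ν) ((2 * (μ + suc ν + μ) + 0) * (6 * (μ + suc ν) + 5)) (suc ν) (2 * w))
  ... | w , inj₂ refl | bound with e , w+t≡3μ ← halve-odd w μ bound =
    mixed-odd∈G (μ + suc ν) (μ + suc ν + μ) 0 μ (suc ν) w e _ refl
      (≤-trans (m≤n+m μ _) (n≤1+n _)) w+t≡3μ
      (valueII-above (μ + suc ν) ((2 * (μ + suc ν + μ) + 0) * (6 * (μ + suc ν) + 5)) (suc ν) (1 + 2 * w))

II₁-run-bound : ∀ μ ν j → j < 2 + 3 * ν → j ≤ 3 * (μ + suc ν)
II₁-run-bound μ ν j j<c = ≤-trans (s≤s⁻¹ j<c) (m+o≡n⇒m≤n (2 + 3 * μ) eq)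
  where eq : 1 + 3 * ν + (2 + 3 * μ) ≡ 3 * (μ + suc ν)
        eq = solve (ν ∷ μ ∷ [])

II₁-mixed-bound : ∀ μ ν l → 3 + (2 + 3 * ν + l) ≤ 6 + 3 * (μ + suc ν + μ) → 2 + l ≤ 6 * suc μ
II₁-mixed-bound μ ν l i<len =
  +-cancelˡ-≤ (3 * ν) _ _ (subst₂ _≤_ eq₁ eq₂ (s≤s⁻¹ (s≤s⁻¹ (s≤s⁻¹ i<len))))
  where eq₁ : 2 + 3 * ν + l ≡ 3 * ν + (2 + l)
        eq₁ = solve (ν ∷ l ∷ [])
        eq₂ : 3 + 3 * (μ + suc ν + μ) ≡ 3 * ν + 6 * suc μ
        eq₂ = solve (μ ∷ ν ∷ [])

II₁∈G : ∀ μ ν i → InWindow (μ + suc ν) (II₁ μ ν) i → G (μ + suc ν) (value (μ + suc ν) (II₁ μ ν) i)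
II₁∈G μ ν zero          _ = II-head∈G (μ + suc ν) (μ + suc ν + μ) 1 ν 0 (m≤m+n _ μ) z<s
II₁∈G μ ν (suc zero)    _ = II-head∈G (μ + suc ν) (μ + suc ν + μ) 1 ν 1 (m≤m+n _ μ) (s≤s z<s)
II₁∈G μ ν (suc (suc j)) inw with j <? 2 + 3 * ν
... | yes j<c with e , j+e≡3k ← m≤n⇒∃[o]m+o≡n (II₁-run-bound μ ν j j<c) =
  run∈G (μ + suc ν) (μ + suc ν + μ) 1 j e _ j+e≡3k (run-slack (μ + suc ν + μ) j+e≡3k (m≤m+n _ μ))
    (valueII-below (μ + suc ν) ((2 * (μ + suc ν + μ) + 1) * (6 * (μ + suc ν) + 5)) ν j j<c)
... | no j≮c with l , refl ← m≤n⇒∃[o]m+o≡n (≮⇒≥ j≮c) with inw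
...   | inj₂ ()
...   | inj₁ i<len with even⊎odd l | II₁-mixed-bound μ ν l i<len
...     | w , inj₁ refl | bound with e , w+e≡3σ ← halve-even w (suc μ) bound =
  mixed-even∈G (μ + suc ν) (μ + suc ν + μ) 1 (suc (μ + suc ν + suc μ)) 0 (suc μ) ν w e _
    (sym (+-suc μ ν)) (solve (μ ∷ ν ∷ [])) (≤-reflexive (+-comm _ 1)) w+e≡3σ
    (valueII-above (μ + suc ν) ((2 * (μ + suc ν + μ) + 1) * (6 * (μ + suc ν) + 5)) ν (2 * w))
...     | w , inj₂ refl | bound with e , w+t≡3σ ← halve-odd w (suc μ) bound =
  mixed-odd∈G (μ + suc ν) (μ + suc ν + μ) 1 (suc μ) ν w e _
    (sym (+-suc μ ν)) (s≤s (m≤n+m μ _)) w+t≡3σ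
    (valueII-above (μ + suc ν) ((2 * (μ + suc ν + μ) + 1) * (6 * (μ + suc ν) + 5)) ν (1 + 2 * w))

value∈G : ∀ k → 1 ≤ k → ∀ σ → Valid k σ → G k (uncurry (value k) σ)
value∈G k 1≤k (I₀ m d , i)  (refl , inj₁ i<len) = I∈G m d 0 i i<len
value∈G k 1≤k (I₁ m d , i)  (refl , inj₁ i<len) = I∈G m d 1 i i<len
value∈G k 1≤k (II₀ μ ν , i) (refl , inw)        = II₀∈G μ ν i 1≤k inw
value∈G k 1≤k (II₁ μ ν , i) (refl , inw)        = II₁∈G μ ν i inw

multiple-beyond : ∀ k N x → 4 * k + 2 ≤ N → x ≡ N * (6 * k + 5) → (4 * k + 1) * (6 * k + 5) + 3 ≤ x
multiple-beyond k N x 4k+2≤N refl with z , refl ← m≤n⇒∃[o]m+o≡n 4k+2≤N =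
  m+o≡n⇒m≤n (6 * k + 2 + z * (6 * k + 5)) eq
  where eq : (4 * k + 1) * (6 * k + 5) + 3 + (6 * k + 2 + z * (6 * k + 5)) ≡ (4 * k + 2 + z) * (6 * k + 5)
        eq = solve (k ∷ z ∷ [])

dip-beyond : ∀ k N t x → 4 * k + 3 ≤ N → t ≤ 3 * k + 3 →
             x + 2 * t ≡ N * (6 * k + 5) → (4 * k + 1) * (6 * k + 5) + 3 ≤ x
dip-beyond k N t x 4k+3≤N t≤ eq
  with z , refl ← m≤n⇒∃[o]m+o≡n 4k+3≤N | u , t+u≡ ← m≤n⇒∃[o]m+o≡n t≤ =
  +-cancelʳ-≤ (2 * t) _ _ (m+o≡n⇒m≤n (2 * u + (6 * k + 1 + z * (6 * k + 5))) (begin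
    (4 * k + 1) * (6 * k + 5) + 3 + 2 * t + (2 * u + (6 * k + 1 + z * (6 * k + 5)))
      ≡⟨ solve (k ∷ t ∷ u ∷ z ∷ []) ⟩
    (4 * k + 1) * (6 * k + 5) + 3 + 2 * (t + u) + (6 * k + 1 + z * (6 * k + 5))
      ≡⟨ cong (λ s → (4 * k + 1) * (6 * k + 5) + 3 + 2 * s + (6 * k + 1 + z * (6 * k + 5))) t+u≡ ⟩
    (4 * k + 1) * (6 * k + 5) + 3 + 2 * (3 * k + 3) + (6 * k + 1 + z * (6 * k + 5))
      ≡⟨ solve (k ∷ z ∷ []) ⟩
    (4 * k + 3 + z) * (6 * k + 5)
      ≡⟨ eq ⟨
    x + 2 * t ∎))

deep-dip-beyond : ∀ k M ε t x → 2 * k + 2 ≤ M → t ≤ 3 * M →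
                  x + 2 * t ≡ (2 * M + ε) * (6 * k + 5) → (4 * k + 1) * (6 * k + 5) + 3 ≤ x
deep-dip-beyond k M ε t x 2k+2≤M t≤3M eq
  with z , refl ← m≤n⇒∃[o]m+o≡n 2k+2≤M | u , t+u≡ ← m≤n⇒∃[o]m+o≡n t≤3M =
  +-cancelʳ-≤ (2 * t) _ _ (m+o≡n⇒m≤n (2 * u + R) (begin
    (4 * k + 1) * (6 * k + 5) + 3 + 2 * t + (2 * u + (6 * k + 12 * k * z + 4 * z + ε * (6 * k + 5)))
      ≡⟨ solve (k ∷ t ∷ u ∷ z ∷ ε ∷ []) ⟩
    (4 * k + 1) * (6 * k + 5) + 3 + 2 * (t + u) + (6 * k + 12 * k * z + 4 * z + ε * (6 * k + 5))
      ≡⟨ cong (λ s → (4 * k + 1) * (6 * k + 5) + 3 + 2 * s + (6 * k + 12 * k * z + 4 * z + ε * (6 * k + 5))) t+u≡ ⟩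
    (4 * k + 1) * (6 * k + 5) + 3 + 2 * (3 * (2 * k + 2 + z)) + (6 * k + 12 * k * z + 4 * z + ε * (6 * k + 5))
      ≡⟨ solve (k ∷ z ∷ ε ∷ []) ⟩
    (2 * (2 * k + 2 + z) + ε) * (6 * k + 5)
      ≡⟨ eq ⟨
    x + 2 * t ∎))
  where R = 6 * k + 12 * k * z + 4 * z + ε * (6 * k + 5)

Covered : ℕ → ℕ → Set
Covered k x = ∃ λ σ → Valid k σ × uncurry (value k) σ ≡ x

same-dip : ∀ {v x s T} → v + s ≡ T → x + s ≡ T → v ≡ x
same-dip {v} {x} {s} v+s≡T x+s≡T = +-cancelʳ-≡ s v x (trans v+s≡T (sym x+s≡T))

II₀-inside : ∀ μ ν X → X ≤ 3 * (μ + ν + μ) → InWindow (μ + ν) (II₀ μ ν) (2 + X)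
II₀-inside μ zero    X _   = inj₂ refl
II₀-inside μ (suc ν) X X≤ = inj₁ (s≤s (s≤s (s≤s X≤)))

II₁-inside : ∀ μ ν X → X ≤ 3 + 3 * (suc (μ + ν) + μ) → InWindow (suc (μ + ν)) (II₁ μ ν) (2 + X)
II₁-inside μ ν X X≤ = inj₁ (s≤s (s≤s (s≤s X≤)))

covered-tail : ∀ k x → (4 * k + 1) * (6 * k + 5) + 3 ≤ x → Covered k x
covered-tail k x F≤x with m≤n⇒∃[o]m+o≡n F≤x
... | zero , refl = (II₀ k 0 , 3) , (sym (+-identityʳ k) , inj₂ refl) , eq
  where eq : (2 * (k + k) + 0) * (6 * k + 5) + (6 * k + 5) + 3 ≡ (4 * k + 1) * (6 * k + 5) + 3 + 0
        eq = solve (k ∷ [])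
... | suc y , refl = (II₀ k 0 , 2 + (2 + 3 * 0 + y)) , (sym (+-identityʳ k) , inj₂ refl) ,
  trans (valueII-above k ((2 * (k + k) + 0) * (6 * k + 5)) 0 y) eq
  where eq : (2 * (k + k) + 0) * (6 * k + 5) + (6 * k + 5) + (2 * (2 + 3 * 0) + y)
           ≡ (4 * k + 1) * (6 * k + 5) + 3 + suc y
        eq = solve (k ∷ y ∷ [])

covered-I : ∀ m d ε t x → 2 ≤ t → t ≤ 3 * suc m →
  x + 2 * t ≡ (2 * suc m + ε) * (6 * suc (m + d) + 5) →
  ∃ λ i → suc i < 3 + 3 * m × valueI (suc (m + d)) ((2 * m + ε) * (6 * suc (m + d) + 5)) d (suc i) ≡ x
covered-I m d ε t x 2≤t t≤3M eq
  with e , refl ← m≤n⇒∃[o]m+o≡n 2≤t | i , t+i≡ ← m≤n⇒∃[o]m+o≡n t≤3M =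
  i , s≤s (s≤s (m+o≡n⇒m≤n e i+e≡)) ,
  same-dip (trans (cong (_+ 2 * (2 + e)) (valueI-run (suc (m + d)) _ d i))
                  (run-dip (suc (m + d)) m ε (3 * d + 2 + i) e (I-run-index m d i e i+e≡))) eq
  where
  i+e≡ : i + e ≡ 1 + 3 * m
  i+e≡ = suc-injective (suc-injective (begin
    2 + (i + e)  ≡⟨ solve (i ∷ e ∷ []) ⟩
    2 + e + i    ≡⟨ t+i≡ ⟩
    3 * suc m    ≡⟨ *-suc 3 m ⟩
    3 + 3 * m    ∎))

covered-multiple : ∀ k N x → x ≡ N * (6 * k + 5) → x ≢ 0 →
                   ¬ (4 * k + 1) * (6 * k + 5) + 3 ≤ x → Covered k x
covered-multiple k zero    x refl x≢0 _ = ⊥-elim (x≢0 refl)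
covered-multiple k (suc N) x refl _ F≰x with even⊎odd N
... | σ , inj₁ refl with σ <? k
...   | yes σ<k with d , refl ← m≤n⇒∃[o]m+o≡n σ<k = (I₀ σ d , 0) , (refl , inj₁ z<s) , eq
  where eq : (2 * σ + 0) * (6 * suc (σ + d) + 5) + (6 * suc (σ + d) + 5) ≡ suc (2 * σ) * (6 * suc (σ + d) + 5)
        eq = solve (σ ∷ d ∷ [])
...   | no σ≮k with μ , refl ← m≤n⇒∃[o]m+o≡n (≮⇒≥ σ≮k) with μ ≤? k
...     | yes μ≤k with ν , refl ← m≤n⇒∃[o]m+o≡n μ≤k =
  (II₀ μ ν , 1) , (refl , inj₁ (s≤s z<s)) , eq
  where eq : (2 * (μ + ν + μ) + 0) * (6 * (μ + ν) + 5) + (6 * (μ + ν) + 5)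
           ≡ suc (2 * (μ + ν + μ)) * (6 * (μ + ν) + 5)
        eq = solve (μ ∷ ν ∷ [])
...     | no μ≰k with z , refl ← m≤n⇒∃[o]m+o≡n (≰⇒> μ≰k) =
  ⊥-elim (F≰x (multiple-beyond k (suc (2 * (k + suc (k + z)))) _ (m+o≡n⇒m≤n (1 + 2 * z) eq) refl))
  where eq : 4 * k + 2 + (1 + 2 * z) ≡ suc (2 * (k + suc (k + z)))
        eq = solve (k ∷ z ∷ [])
covered-multiple k (suc N) x refl _ F≰x | σ , inj₂ refl with σ <? k
...   | yes σ<k with d , refl ← m≤n⇒∃[o]m+o≡n σ<k = (I₁ σ d , 0) , (refl , inj₁ z<s) , eq
  where eq : (2 * σ + 1) * (6 * suc (σ + d) + 5) + (6 * suc (σ + d) + 5) ≡ suc (1 + 2 * σ) * (6 * suc (σ + d) + 5)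
        eq = solve (σ ∷ d ∷ [])
...   | no σ≮k with μ , refl ← m≤n⇒∃[o]m+o≡n (≮⇒≥ σ≮k) with μ <? k
...     | yes μ<k with ν , refl ← m≤n⇒∃[o]m+o≡n μ<k =
  (II₁ μ ν , 1) , (sym (+-suc μ ν) , inj₁ (s≤s z<s)) , eq
  where eq : (2 * (suc (μ + ν) + μ) + 1) * (6 * suc (μ + ν) + 5) + (6 * suc (μ + ν) + 5)
           ≡ suc (1 + 2 * (suc (μ + ν) + μ)) * (6 * suc (μ + ν) + 5)
        eq = solve (μ ∷ ν ∷ [])
...     | no μ≮k with z , refl ← m≤n⇒∃[o]m+o≡n (≮⇒≥ μ≮k) =
  ⊥-elim (F≰x (multiple-beyond k (suc (1 + 2 * (k + (k + z)))) _ (m+o≡n⇒m≤n (2 * z) eq) refl))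
  where eq : 4 * k + 2 + 2 * z ≡ suc (1 + 2 * (k + (k + z)))
        eq = solve (k ∷ z ∷ [])

covered-head : ∀ k μ ε x → ε ≤ 1 → x + 2 * (3 * k + 3) ≡ (2 * suc (k + μ) + ε) * (6 * k + 5) →
               ¬ (4 * k + 1) * (6 * k + 5) + 3 ≤ x → Covered k x
covered-head k μ zero x _ eq F≰x with μ ≤? k
... | yes μ≤k with ν , refl ← m≤n⇒∃[o]m+o≡n μ≤k =
  (II₀ μ ν , 0) , (refl , inj₁ z<s) , same-dip (head-dip (μ + ν) (μ + ν + μ) 0) eq
... | no μ≰k with z , refl ← m≤n⇒∃[o]m+o≡n (≰⇒> μ≰k) =
  ⊥-elim (F≰x (dip-beyond k (2 * suc (k + suc (k + z)) + 0) _ x (m+o≡n⇒m≤n (1 + 2 * z) eq′) ≤-refl eq))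
  where eq′ : 4 * k + 3 + (1 + 2 * z) ≡ 2 * suc (k + suc (k + z)) + 0
        eq′ = solve (k ∷ z ∷ [])
covered-head k μ (suc zero) x _ eq F≰x with μ <? k
... | yes μ<k with ν , refl ← m≤n⇒∃[o]m+o≡n μ<k =
  (II₁ μ ν , 0) , (sym (+-suc μ ν) , inj₁ z<s) , same-dip (head-dip (suc (μ + ν)) (suc (μ + ν) + μ) 1) eq
... | no μ≮k with z , refl ← m≤n⇒∃[o]m+o≡n (≮⇒≥ μ≮k) =
  ⊥-elim (F≰x (dip-beyond k (2 * suc (k + (k + z)) + 1) _ x (m+o≡n⇒m≤n (2 * z) eq′) ≤-refl eq))
  where eq′ : 4 * k + 3 + 2 * z ≡ 2 * suc (k + (k + z)) + 1
        eq′ = solve (k ∷ z ∷ [])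
covered-head k μ (suc (suc ε)) x (s≤s ()) eq F≰x

run-index : ∀ k σ ν e → σ + ν ≡ k → 3 * σ < 2 + e → 2 + e < 3 * k + 3 →
            ∃ λ j → j + e ≡ 3 * k × j < 2 + 3 * ν
run-index k σ ν e σ+ν≡k 3σ<t t<3k+3 = from (m≤n⇒∃[o]m+o≡n e≤3k)
  where
  e≤3k : e ≤ 3 * k
  e≤3k = +-cancelʳ-≤ 3 e (3 * k) (subst (_≤ 3 * k + 3) (+-comm 3 e) t<3k+3)
  from : ∃ (λ j → e + j ≡ 3 * k) → ∃ λ j → j + e ≡ 3 * k × j < 2 + 3 * ν
  from (j , e+j≡3k) = j , j+e≡3k ,
    +-cancelˡ-< (3 * σ) j (2 + 3 * ν) (<-≤-trans (+-monoˡ-< j 3σ<t) (≤-reflexive (begin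
      2 + e + j           ≡⟨ solve (e ∷ j ∷ []) ⟩
      2 + (j + e)         ≡⟨ cong (2 +_) j+e≡3k ⟩
      2 + 3 * k           ≡⟨ cong (λ z → 2 + 3 * z) σ+ν≡k ⟨
      2 + 3 * (σ + ν)     ≡⟨ solve (σ ∷ ν ∷ []) ⟩
      3 * σ + (2 + 3 * ν) ∎)))
    where j+e≡3k = trans (+-comm j e) e+j≡3k

odd-offset≤ : ∀ σ ν w e B → w + (2 + e) ≡ 3 * σ → 3 * ν + 6 * σ ≡ B → 2 + 3 * ν + (1 + 2 * w) ≤ B
odd-offset≤ σ ν w e B w+t≡3σ bound = m+o≡n⇒m≤n (1 + 2 * e) (begin
  2 + 3 * ν + (1 + 2 * w) + (1 + 2 * e) ≡⟨ solve (ν ∷ w ∷ e ∷ []) ⟩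
  3 * ν + 2 * (w + (2 + e))             ≡⟨ cong (λ z → 3 * ν + 2 * z) w+t≡3σ ⟩
  3 * ν + 2 * (3 * σ)                   ≡⟨ solve (ν ∷ σ ∷ []) ⟩
  3 * ν + 6 * σ                         ≡⟨ bound ⟩
  B                                     ∎)

even-offset≤ : ∀ σ ν w e B → suc w + e ≡ 3 * σ → 3 * ν + 6 * σ ≡ B → 2 + 3 * ν + 2 * w ≤ B
even-offset≤ σ ν w e B w+e≡3σ bound = m+o≡n⇒m≤n (2 * e) (begin
  2 + 3 * ν + 2 * w + 2 * e ≡⟨ solve (ν ∷ w ∷ e ∷ []) ⟩
  3 * ν + 2 * (suc w + e)   ≡⟨ cong (λ z → 3 * ν + 2 * z) w+e≡3σ ⟩
  3 * ν + 2 * (3 * σ)       ≡⟨ solve (ν ∷ σ ∷ []) ⟩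
  3 * ν + 6 * σ             ≡⟨ bound ⟩
  B                         ∎)

covered-shallow₀ : ∀ k μ t x → 2 ≤ t → t < 3 * k + 3 →
  x + 2 * t ≡ (2 * suc (k + μ) + 0) * (6 * k + 5) → ¬ (4 * k + 1) * (6 * k + 5) + 3 ≤ x → Covered k x
covered-shallow₀ k μ t x 2≤t t<3k+3 eq F≰x with μ ≤? k
... | no μ≰k with z , refl ← m≤n⇒∃[o]m+o≡n (≰⇒> μ≰k) =
  ⊥-elim (F≰x (dip-beyond k (2 * suc (k + suc (k + z)) + 0) t x (m+o≡n⇒m≤n (1 + 2 * z) eq′) (<⇒≤ t<3k+3) eq))
  where eq′ : 4 * k + 3 + (1 + 2 * z) ≡ 2 * suc (k + suc (k + z)) + 0
        eq′ = solve (k ∷ z ∷ [])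
... | yes μ≤k with ν , refl ← m≤n⇒∃[o]m+o≡n μ≤k | e , refl ← m≤n⇒∃[o]m+o≡n 2≤t with 3 * μ <? 2 + e
...   | yes 3μ<t with j , j+e≡3k , j<c ← run-index (μ + ν) μ ν e refl 3μ<t t<3k+3 =
  (II₀ μ ν , 2 + j) ,
  (refl , II₀-inside μ ν j (≤-trans (m+n≤o⇒m≤o j (≤-reflexive j+e≡3k)) (*-monoʳ-≤ 3 (m≤m+n (μ + ν) μ)))) ,
  same-dip (trans (cong (_+ 2 * (2 + e)) (valueII-below (μ + ν) ((2 * (μ + ν + μ) + 0) * (6 * (μ + ν) + 5)) ν j j<c))
                  (run-dip (μ + ν) (μ + ν + μ) 0 j e j+e≡3k)) eq
...   | no 3μ≮t with w , t+w≡ ← m≤n⇒∃[o]m+o≡n (≮⇒≥ 3μ≮t) =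
  (II₀ μ ν , 2 + (2 + 3 * ν + (1 + 2 * w))) ,
  (refl , II₀-inside μ ν _ (odd-offset≤ μ ν w e _ w+t≡3μ (solve (ν ∷ μ ∷ [])))) ,
  same-dip (trans (cong (_+ 2 * (2 + e)) (valueII-above (μ + ν) ((2 * (μ + ν + μ) + 0) * (6 * (μ + ν) + 5)) ν (1 + 2 * w)))
                  (odd-dip (μ + ν) (μ + ν + μ) 0 μ ν w e refl w+t≡3μ)) eq
  where w+t≡3μ : w + (2 + e) ≡ 3 * μ
        w+t≡3μ = trans (+-comm w (2 + e)) t+w≡

covered-shallow₁ : ∀ k μ t x → 2 ≤ t → t < 3 * k + 3 →
  x + 2 * t ≡ (2 * suc (k + μ) + 1) * (6 * k + 5) → ¬ (4 * k + 1) * (6 * k + 5) + 3 ≤ x → Covered k x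
covered-shallow₁ k μ t x 2≤t t<3k+3 eq F≰x with μ <? k
... | no μ≮k with z , refl ← m≤n⇒∃[o]m+o≡n (≮⇒≥ μ≮k) =
  ⊥-elim (F≰x (dip-beyond k (2 * suc (k + (k + z)) + 1) t x (m+o≡n⇒m≤n (2 * z) eq′) (<⇒≤ t<3k+3) eq))
  where eq′ : 4 * k + 3 + 2 * z ≡ 2 * suc (k + (k + z)) + 1
        eq′ = solve (k ∷ z ∷ [])
... | yes μ<k with ν , refl ← m≤n⇒∃[o]m+o≡n μ<k | e , refl ← m≤n⇒∃[o]m+o≡n 2≤t with 3 * suc μ <? 2 + e
...   | yes 3σ<t with j , j+e≡3k , j<c ← run-index (suc (μ + ν)) (suc μ) ν e refl 3σ<t t<3k+3 =
  (II₁ μ ν , 2 + j) ,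
  (sym (+-suc μ ν) , II₁-inside μ ν j (≤-trans (m+n≤o⇒m≤o j (≤-reflexive j+e≡3k))
                                               (≤-trans (*-monoʳ-≤ 3 (m≤m+n (suc (μ + ν)) μ))
                                                        (m≤n+m (3 * (suc (μ + ν) + μ)) 3)))) ,
  same-dip (trans (cong (_+ 2 * (2 + e)) (valueII-below (suc (μ + ν)) ((2 * (suc (μ + ν) + μ) + 1) * (6 * suc (μ + ν) + 5)) ν j j<c))
                  (run-dip (suc (μ + ν)) (suc (μ + ν) + μ) 1 j e j+e≡3k)) eq
...   | no 3σ≮t with w , t+w≡ ← m≤n⇒∃[o]m+o≡n (≮⇒≥ 3σ≮t) =
  (II₁ μ ν , 2 + (2 + 3 * ν + (1 + 2 * w))) ,
  (sym (+-suc μ ν) , II₁-inside μ ν _ (odd-offset≤ (suc μ) ν w e _ w+t≡3σ (solve (ν ∷ μ ∷ [])))) ,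
  same-dip (trans (cong (_+ 2 * (2 + e)) (valueII-above (suc (μ + ν)) ((2 * (suc (μ + ν) + μ) + 1) * (6 * suc (μ + ν) + 5)) ν (1 + 2 * w)))
                  (odd-dip (suc (μ + ν)) (suc (μ + ν) + μ) 1 (suc μ) ν w e refl w+t≡3σ)) eq
  where w+t≡3σ : w + (2 + e) ≡ 3 * suc μ
        w+t≡3σ = trans (+-comm w (2 + e)) t+w≡

covered-shallow : ∀ k μ ε t x → ε ≤ 1 → 2 ≤ t → t < 3 * k + 3 →
  x + 2 * t ≡ (2 * suc (k + μ) + ε) * (6 * k + 5) → ¬ (4 * k + 1) * (6 * k + 5) + 3 ≤ x → Covered k x
covered-shallow k μ zero          t x _        = covered-shallow₀ k μ t x
covered-shallow k μ (suc zero)    t x _        = covered-shallow₁ k μ t x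
covered-shallow k μ (suc (suc ε)) t x (s≤s ())

deep-slack : ∀ k μ e → 3 * k + 4 + e ≤ 3 * suc (k + μ) → ∃ λ w → suc w + e ≡ 3 * μ
deep-slack k μ e t≤ =
  Data.Product.map₂ (λ {w} e+w≡ → trans (cong suc (+-comm w e)) e+w≡)
    (m≤n⇒∃[o]m+o≡n (+-cancelˡ-≤ (3 * k + 3) (suc e) (3 * μ) (subst₂ _≤_ eq₁ eq₂ t≤)))
  where
  eq₁ : 3 * k + 4 + e ≡ 3 * k + 3 + suc e
  eq₁ = solve (k ∷ e ∷ [])
  eq₂ : 3 * suc (k + μ) ≡ 3 * k + 3 + 3 * μ
  eq₂ = solve (k ∷ μ ∷ [])

covered-deep : ∀ k μ ε e x → ε ≤ 1 → 3 * k + 4 + e ≤ 3 * suc (k + μ) →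
  x + 2 * (3 * k + 4 + e) ≡ (2 * suc (k + μ) + ε) * (6 * k + 5) →
  ¬ (4 * k + 1) * (6 * k + 5) + 3 ≤ x → Covered k x
covered-deep k zero zero e x _ t≤ eq F≰x = ⊥-elim (<⇒≱ (m+o≡n⇒m≤n e 3k+4≡) t≤)
  where 3k+4≡ : suc (3 * suc (k + 0)) + e ≡ 3 * k + 4 + e
        3k+4≡ = solve (k ∷ e ∷ [])
covered-deep k (suc μ) zero e x _ t≤ eq F≰x with μ <? k
... | no μ≮k with z , refl ← m≤n⇒∃[o]m+o≡n (≮⇒≥ μ≮k) =
  ⊥-elim (F≰x (deep-dip-beyond k (suc (k + suc (k + z))) 0 _ x (m+o≡n⇒m≤n z eq′) t≤ eq))
  where eq′ : 2 * k + 2 + z ≡ suc (k + suc (k + z))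
        eq′ = solve (k ∷ z ∷ [])
... | yes μ<k with ν , refl ← m≤n⇒∃[o]m+o≡n μ<k with w , w+e≡3σ ← deep-slack (suc (μ + ν)) (suc μ) e t≤ =
  (II₁ μ ν , 2 + (2 + 3 * ν + 2 * w)) ,
  (sym (+-suc μ ν) , II₁-inside μ ν _ (even-offset≤ (suc μ) ν w e _ w+e≡3σ (solve (ν ∷ μ ∷ [])))) ,
  same-dip (trans (cong (_+ 2 * (3 * suc (μ + ν) + 4 + e))
                        (valueII-above (suc (μ + ν)) ((2 * (suc (μ + ν) + μ) + 1) * (6 * suc (μ + ν) + 5)) ν (2 * w)))
                  (trans (even-dip (suc (μ + ν)) (suc (μ + ν) + μ) 1 (suc μ) ν w e refl w+e≡3σ)
                         (cong (_* (6 * suc (μ + ν) + 5)) layer≡))) eq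
  where layer≡ : 2 * (suc (μ + ν) + μ) + 1 + 3 ≡ 2 * suc (suc (μ + ν) + suc μ) + 0
        layer≡ = solve (μ ∷ ν ∷ [])
covered-deep k μ (suc zero) e x _ t≤ eq F≰x with μ ≤? k
... | no μ≰k with z , refl ← m≤n⇒∃[o]m+o≡n (≰⇒> μ≰k) =
  ⊥-elim (F≰x (deep-dip-beyond k (suc (k + suc (k + z))) 1 _ x (m+o≡n⇒m≤n z eq′) t≤ eq))
  where eq′ : 2 * k + 2 + z ≡ suc (k + suc (k + z))
        eq′ = solve (k ∷ z ∷ [])
... | yes μ≤k with ν , refl ← m≤n⇒∃[o]m+o≡n μ≤k with w , w+e≡3μ ← deep-slack (μ + ν) μ e t≤ =
  (II₀ μ ν , 2 + (2 + 3 * ν + 2 * w)) ,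
  (refl , II₀-inside μ ν _ (even-offset≤ μ ν w e _ w+e≡3μ (solve (ν ∷ μ ∷ [])))) ,
  same-dip (trans (cong (_+ 2 * (3 * (μ + ν) + 4 + e))
                        (valueII-above (μ + ν) ((2 * (μ + ν + μ) + 0) * (6 * (μ + ν) + 5)) ν (2 * w)))
                  (trans (even-dip (μ + ν) (μ + ν + μ) 0 μ ν w e refl w+e≡3μ)
                         (cong (_* (6 * (μ + ν) + 5)) layer≡))) eq
  where layer≡ : 2 * (μ + ν + μ) + 0 + 3 ≡ 2 * suc (μ + ν + μ) + 1
        layer≡ = solve (μ ∷ ν ∷ [])
covered-deep k μ (suc (suc ε)) e x (s≤s ()) t≤ eq F≰x

covered-dip : ∀ k M ε t x → ε ≤ 1 → 2 ≤ t → t ≤ 3 * M →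
  x + 2 * t ≡ (2 * M + ε) * (6 * k + 5) → ¬ (4 * k + 1) * (6 * k + 5) + 3 ≤ x → Covered k x
covered-dip k zero    ε t x ε≤1 2≤t t≤0 eq F≰x = contradiction (≤-trans 2≤t t≤0) λ ()
covered-dip k (suc m) ε t x ε≤1 2≤t t≤3M eq F≰x with m <? k
... | yes m<k with d , refl ← m≤n⇒∃[o]m+o≡n m<k
  with i , i<len , v≡x ← covered-I m d ε t x 2≤t t≤3M eq with ε | ε≤1
...   | zero        | _      = (I₀ m d , suc i) , (refl , inj₁ i<len) , v≡x
...   | suc zero    | _      = (I₁ m d , suc i) , (refl , inj₁ i<len) , v≡x
...   | suc (suc _) | s≤s ()
covered-dip k (suc m) ε t x ε≤1 2≤t t≤3M eq F≰x | no m≮k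
  with μ , refl ← m≤n⇒∃[o]m+o≡n (≮⇒≥ m≮k) with <-cmp t (3 * k + 3)
... | tri< t<3k+3 _ _ = covered-shallow k μ ε t x ε≤1 2≤t t<3k+3 eq F≰x
... | tri≈ _ refl _   = covered-head k μ ε x ε≤1 eq F≰x
... | tri> _ _ 3k+3<t with e , refl ← m≤n⇒∃[o]m+o≡n 3k+3<t =
  covered-deep k μ ε e x ε≤1 (subst (_≤ 3 * suc (k + μ)) t≡ t≤3M)
    (subst (λ s → x + 2 * s ≡ (2 * suc (k + μ) + ε) * (6 * k + 5)) t≡ eq) F≰x
  where t≡ : suc (3 * k + 3) + e ≡ 3 * k + 4 + e
        t≡ = solve (k ∷ e ∷ [])

covered : ∀ k x → G k x → x ≢ 0 → Covered k x
covered k x x∈G x≢0 with (4 * k + 1) * (6 * k + 5) + 3 ≤? x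
... | yes F≤x = covered-tail k x F≤x
... | no F≰x with Repr⇒Layered k (⟨S₃⟩⇒Repr k x∈G)
...   | multiple N x≡ = covered-multiple k N x x≡ x≢0 F≰x
...   | dip M ε t ε≤1 2≤t t≤3M eq = covered-dip k M ε t x ε≤1 2≤t t≤3M eq F≰x

spread : Fin 3 → Fin 2 → Fin 3 → ℕ
spread ρ δ i = (toℕ ρ + toℕ i * suc (toℕ δ)) % 3

SpreadBijective : Fin 3 → Fin 2 → Set
SpreadBijective ρ δ =
  (∀ (r : Fin 3) → ∃ λ i → spread ρ δ i ≡ toℕ r) × (∀ i j → spread ρ δ i ≡ spread ρ δ j → i ≡ j)

spread-bijective : ∀ ρ δ → SpreadBijective ρ δ
spread-bijective = toWitness {a? = all? λ ρ → all? λ δ → bijective? ρ δ} tt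
  where
  bijective? : ∀ ρ δ → Dec (SpreadBijective ρ δ)
  bijective? ρ δ = all? (λ (r : Fin 3) → any? λ i → spread ρ δ i ≟ toℕ r)
             ×-dec all? (λ i → all? λ j → (spread ρ δ i ≟ spread ρ δ j) →-dec (i ≟ᶠ j))

EvenlySpaced₃ : ℕ → ℕ → ℕ → Set
EvenlySpaced₃ v₀ v₁ v₂ = Σ (Fin 2) λ δ → ∃ λ p → ∃ λ q →
  v₁ ≡ v₀ + (suc (toℕ δ) + 3 * p) × v₂ ≡ v₁ + (suc (toℕ δ) + 3 * q)

shift%3 : ∀ x c q → (x + (c + 3 * q)) % 3 ≡ (x % 3 + c) % 3
shift%3 x c q = begin
  (x + (c + 3 * q)) % 3                 ≡⟨ cong (λ y → (y + (c + 3 * q)) % 3) (m≡m%n+[m/n]*n x 3) ⟩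
  (x % 3 + x / 3 * 3 + (c + 3 * q)) % 3 ≡⟨ cong (_% 3) (regroup (x % 3) (x / 3)) ⟩
  (x % 3 + c + (x / 3 + q) * 3) % 3     ≡⟨ [m+kn]%n≡m%n (x % 3 + c) (x / 3 + q) 3 ⟩
  (x % 3 + c) % 3                       ∎
  where regroup : ∀ ρ h → ρ + h * 3 + (c + 3 * q) ≡ ρ + c + (h + q) * 3
        regroup ρ h = solve (ρ ∷ h ∷ c ∷ q ∷ [])

evenly-spaced⇒residues : ∀ (F : Fin 3 → ℕ) → EvenlySpaced₃ (F zero) (F (suc zero)) (F (suc (suc zero))) →
                         ∀ (r : Fin 3) → ∃! _≡_ (λ i → F i % 3 ≡ toℕ r)
evenly-spaced⇒residues F (δ , p , q , F₁≡ , F₂≡) r =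
  i , trans (F%3≡ i) hit ,
  λ {j} Fj≡r → injective i j (trans hit (trans (sym Fj≡r) (F%3≡ j)))
  where
  ρ = fromℕ< (m%n<n (F zero) 3)
  d = suc (toℕ δ)
  i = proj₁ (proj₁ (spread-bijective ρ δ) r)
  hit = proj₂ (proj₁ (spread-bijective ρ δ) r)
  injective = proj₂ (spread-bijective ρ δ)
  to-spread : ∀ i → (F zero % 3 + toℕ i * d) % 3 ≡ spread ρ δ i
  to-spread i = cong (λ z → (z + toℕ i * d) % 3) (sym (toℕ-fromℕ< (m%n<n (F zero) 3)))
  F₂≡′ : F (suc (suc zero)) ≡ F zero + (2 * d + 3 * (p + q))
  F₂≡′ = trans F₂≡ (trans (cong (_+ (d + 3 * q)) F₁≡) (regroup (F zero) d))
    where regroup : ∀ v d → v + (d + 3 * p) + (d + 3 * q) ≡ v + (2 * d + 3 * (p + q))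
          regroup v d = solve (v ∷ d ∷ p ∷ q ∷ [])
  F%3≡ : ∀ i → F i % 3 ≡ spread ρ δ i
  F%3≡ zero = trans (sym (trans (cong (_% 3) (+-identityʳ (F zero % 3))) (m%n%n≡m%n (F zero) 3)))
                    (to-spread zero)
  F%3≡ (suc zero) = trans (cong (_% 3) F₁≡)
    (trans (shift%3 (F zero) d p) (trans (cong (λ z → (F zero % 3 + z) % 3) (sym (*-identityˡ d)))
                                         (to-spread (suc zero))))
  F%3≡ (suc (suc zero)) = trans (cong (_% 3) F₂≡′)
    (trans (shift%3 (F zero) (2 * d) (p + q)) (to-spread (suc (suc zero))))

offset-gap-below : ∀ c i → suc i < c → offset c (suc i) ≡ 2 + offset c i
offset-gap-below (suc (suc c)) zero    _             = refl
offset-gap-below (suc c)       (suc i) (s≤s i+1<c) = cong (2 +_) (offset-gap-below c i i+1<c)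

offset-gap-above : ∀ c i → c ≤ suc i → offset c (suc i) ≡ 1 + offset c i
offset-gap-above zero          i       _          = refl
offset-gap-above (suc zero)    zero    _          = refl
offset-gap-above (suc (suc c)) zero    (s≤s ())
offset-gap-above (suc c)       (suc i) (s≤s c≤i+1) = cong (2 +_) (offset-gap-above c i c≤i+1)

add-gap : ∀ x g o → x + (g + o) ≡ x + o + g
add-gap x g o = solve (x ∷ g ∷ o ∷ [])

Aligned : (ℕ → ℕ) → Set
Aligned f = ∀ e → EvenlySpaced₃ (f (3 * e)) (f (1 + 3 * e)) (f (2 + 3 * e))

aligned-from-3 : ∀ f → EvenlySpaced₃ (f 0) (f 1) (f 2) →
  (∀ e → EvenlySpaced₃ (f (3 + 3 * e)) (f (4 + 3 * e)) (f (5 + 3 * e))) → Aligned f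
aligned-from-3 f first _    zero    = first
aligned-from-3 f _     rest (suc e) =
  subst (λ i → EvenlySpaced₃ (f i) (f (1 + i)) (f (2 + i))) (sym (*-suc 3 e)) (rest e)

I-aligned : ∀ k P d → Aligned (valueI k P d)
I-aligned k P d = aligned-from-3 (valueI k P d) (suc zero , 2 * d + 1 , 0 , gap₀ , gap 0)
                                 (λ e → suc zero , 0 , 0 , gap (2 + 3 * e) , gap (3 + 3 * e))
  where
  gap₀ : P + (6 * k + 5) + 6 * d + 5 + 2 * 0 ≡ P + (6 * k + 5) + (2 + 3 * (2 * d + 1))
  gap₀ = solve (P ∷ k ∷ d ∷ [])
  gap : ∀ i → P + (6 * k + 5) + 6 * d + 5 + 2 * suc i ≡ P + (6 * k + 5) + 6 * d + 5 + 2 * i + 2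
  gap i = solve (P ∷ k ∷ d ∷ i ∷ [])

II-aligned : ∀ k P ν → Aligned (valueII k P ν)
II-aligned k P ν = aligned-from-3 (valueII k P ν) (zero , 0 , 0 , gap₀ , refl) rest
  where
  gap₀ : P + (6 * k + 5) ≡ P + (6 * k + 4) + 1
  gap₀ = solve (P ∷ k ∷ [])
  c = 2 + 3 * ν
  rest : ∀ e → EvenlySpaced₃ (valueII k P ν (3 + 3 * e)) (valueII k P ν (4 + 3 * e)) (valueII k P ν (5 + 3 * e))
  rest e with e <? ν
  ... | yes e<ν = suc zero , 0 , 0 ,
    trans (cong (P + (6 * k + 5) +_) (offset-gap-below c (1 + 3 * e) (≤-trans (s≤s (n≤1+n _)) 4+3e≤c)))
          (add-gap _ 2 _) ,
    trans (cong (P + (6 * k + 5) +_) (offset-gap-below c (2 + 3 * e) 4+3e≤c)) (add-gap _ 2 _)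
    where 4+3e≤c : 4 + 3 * e ≤ 2 + 3 * ν
          4+3e≤c = ≤-trans (s≤s (subst (_≤ 3 * ν) (*-suc 3 e) (*-monoʳ-≤ 3 e<ν))) (n≤1+n _)
  ... | no e≮ν = zero , 0 , 0 ,
    trans (cong (P + (6 * k + 5) +_) (offset-gap-above c (1 + 3 * e) c≤2+3e)) (add-gap _ 1 _) ,
    trans (cong (P + (6 * k + 5) +_) (offset-gap-above c (2 + 3 * e) (≤-trans c≤2+3e (n≤1+n _)))) (add-gap _ 1 _)
    where c≤2+3e : 2 + 3 * ν ≤ 2 + 3 * e
          c≤2+3e = +-monoʳ-≤ 2 (*-monoʳ-≤ 3 (≮⇒≥ e≮ν))

value-aligned : ∀ k w → Aligned (value k w)
value-aligned k (I₀ m d)  = I-aligned k _ d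
value-aligned k (I₁ m d)  = I-aligned k _ d
value-aligned k (II₀ μ ν) = II-aligned k _ ν
value-aligned k (II₁ μ ν) = II-aligned k _ ν

block-inside : ∀ k w e → InWindow k w (3 * e) → InWindow k w (2 + 3 * e)
block-inside k w e (inj₂ tail)   = inj₂ tail
block-inside k w e (inj₁ 3e<len) with l , len≡ ← length≡3* k w =
  inj₁ (subst₂ _≤_ (*-suc 3 e) (sym len≡) (*-monoʳ-≤ 3 (*-cancelˡ-< 3 e l (subst (3 * e <_) len≡ 3e<len))))

aligned-index : ∀ b c i → b * 3 ≡ 3 * c + i → i ≡ 3 * (b ∸ c)
aligned-index b c i b*3≡ = begin
  i                    ≡⟨ m+n∸m≡n (3 * c) i ⟨
  3 * c + i ∸ 3 * c    ≡⟨ cong (_∸ 3 * c) b*3≡ ⟨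
  b * 3 ∸ 3 * c        ≡⟨ cong (_∸ 3 * c) (*-comm b 3) ⟩
  3 * b ∸ 3 * c        ≡⟨ *-distribˡ-∸ 3 b c ⟨
  3 * (b ∸ c)          ∎

block-states : ∀ k → 1 ≤ k → ∀ b → ∃ λ w → ∃ λ e →
               ∀ (i : Fin 3) → state k (b * 3 + toℕ i) ≡ (w , toℕ i + 3 * e)
block-states k 1≤k b
  with state k (b * 3) in σ≡ | state-valid k 1≤k (b * 3) | state-aligned k 1≤k (b * 3)
... | w , i | _ , inw | c , b*3≡ with refl ← aligned-index b c i b*3≡ = w , b ∸ c , states
  where
  e = b ∸ c
  inw₂ : InWindow k w (2 + 3 * e)
  inw₂ = block-inside k w e inw
  state₁ : state k (b * 3 + 1) ≡ (w , 1 + 3 * e)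
  state₁ = begin
    state k (b * 3 + 1)       ≡⟨ cong (state k) (+-comm (b * 3) 1) ⟩
    step k (state k (b * 3))  ≡⟨ cong (step k) σ≡ ⟩
    step k (w , 3 * e)        ≡⟨ step-within k w (3 * e) (Data.Sum.map₁ <⇒≤ inw₂) ⟩
    (w , 1 + 3 * e)           ∎
  states : ∀ (i : Fin 3) → state k (b * 3 + toℕ i) ≡ (w , toℕ i + 3 * e)
  states zero             = trans (cong (state k) (+-identityʳ (b * 3))) σ≡
  states (suc zero)       = state₁
  states (suc (suc zero)) = begin
    state k (b * 3 + 2)          ≡⟨ cong (state k) (+-comm (b * 3) 2) ⟩
    step k (state k (1 + b * 3)) ≡⟨ cong (λ n → step k (state k n)) (+-comm 1 (b * 3)) ⟩
    step k (state k (b * 3 + 1)) ≡⟨ cong (step k) state₁ ⟩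
    step k (w , 1 + 3 * e)       ≡⟨ step-within k w (1 + 3 * e) inw₂ ⟩
    (w , 2 + 3 * e)              ∎

EvenlySpaced₃-resp : ∀ {v₀ v₁ v₂ u₀ u₁ u₂} → v₀ ≡ u₀ → v₁ ≡ u₁ → v₂ ≡ u₂ →
                     EvenlySpaced₃ v₀ v₁ v₂ → EvenlySpaced₃ u₀ u₁ u₂
EvenlySpaced₃-resp refl refl refl spaced = spaced

⟨⟩-mono : ∀ {S T : ℕ → Set} → (∀ {y} → S y → T y) → ∀ {x} → ⟨ S ⟩ x → ⟨ T ⟩ x
⟨⟩-mono S⊆T gen-0       = gen-0
⟨⟩-mono S⊆T (gen-∈ y∈S) = gen-∈ (S⊆T y∈S)
⟨⟩-mono S⊆T (gen-+ x y) = gen-+ (⟨⟩-mono S⊆T x) (⟨⟩-mono S⊆T y)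

enumerate-range : ∀ k x → G (suc k) x ⇔ (∃ λ i → enumerate (suc k) i ≡ x)
enumerate-range k x = mk⇔ to from
  where
  to : G (suc k) x → ∃ λ i → enumerate (suc k) i ≡ x
  to x∈G with x ≟ 0
  ... | yes refl = 0 , refl
  ... | no x≢0 with σ , valid , value≡x ← covered (suc k) x x∈G x≢0
               with n , state≡σ ← valid⇒reachable k σ valid =
    suc n , trans (cong (uncurry (value (suc k))) state≡σ) value≡x
  from : (∃ λ i → enumerate (suc k) i ≡ x) → G (suc k) x
  from (zero  , refl) = gen-0
  from (suc n , refl) = value∈G (suc k) (s≤s z≤n) (state (suc k) n) (state-valid (suc k) (s≤s z≤n) n)

enumerate-generates : ∀ k →
  ⟨ S₃ (suc k) ⟩ ≐ ⟨ (λ y → ∃ λ i → (1 ≤ i × i ≤ 3) × enumerate (suc k) i ≡ y) ⟩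
enumerate-generates k x = mk⇔ (⟨⟩-mono S₃⊆) (⟨⟩-mono ⊆S₃)
  where
  g₂ : enumerate (suc k) 2 ≡ gen-b (suc k)
  g₂ = trans eq (sym (gen-b≡ (suc k)))
    where eq : 6 * suc k + 5 + 6 * k + 5 + 2 * 0 ≡ 12 * suc k + 4
          eq = solve (k ∷ [])
  g₃ : enumerate (suc k) 3 ≡ gen-c (suc k)
  g₃ = trans eq (sym (gen-c≡ (suc k)))
    where eq : 6 * suc k + 5 + 6 * k + 5 + 2 * 1 ≡ 12 * suc k + 6
          eq = solve (k ∷ [])
  S₃⊆ : ∀ {y} → S₃ (suc k) y → ∃ λ i → (1 ≤ i × i ≤ 3) × enumerate (suc k) i ≡ y
  S₃⊆ (inj₁ refl)        = 1 , (s≤s z≤n , s≤s z≤n) , refl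
  S₃⊆ (inj₂ (inj₁ refl)) = 2 , (s≤s z≤n , s≤s (s≤s z≤n)) , g₂
  S₃⊆ (inj₂ (inj₂ refl)) = 3 , (s≤s z≤n , s≤s (s≤s (s≤s z≤n))) , g₃
  ⊆S₃ : ∀ {y} → (∃ λ i → (1 ≤ i × i ≤ 3) × enumerate (suc k) i ≡ y) → S₃ (suc k) y
  ⊆S₃ (1 , _ , refl) = inj₁ refl
  ⊆S₃ (2 , _ , refl) = inj₂ (inj₁ g₂)
  ⊆S₃ (3 , _ , refl) = inj₂ (inj₂ g₃)
  ⊆S₃ (suc (suc (suc (suc _))) , (_ , s≤s (s≤s (s≤s ()))) , _)

enumerate-blocks : ∀ k b (r : Fin 3) →
  ∃! _≡_ (λ (i : Fin 3) → enumerate (suc k) (b * 3 + suc (toℕ i)) % 3 ≡ toℕ r)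
enumerate-blocks k b r with w , e , states ← block-states (suc k) (s≤s z≤n) b =
  evenly-spaced⇒residues F
    (EvenlySpaced₃-resp (value≡F zero) (value≡F (suc zero)) (value≡F (suc (suc zero)))
                        (value-aligned (suc k) w e)) r
  where
  F : Fin 3 → ℕ
  F i = enumerate (suc k) (b * 3 + suc (toℕ i))
  value≡F : ∀ i → value (suc k) w (toℕ i + 3 * e) ≡ F i
  value≡F i = sym (trans (cong (enumerate (suc k)) (+-suc (b * 3) (toℕ i)))
                         (cong (uncurry (value (suc k))) (states i)))

lemma4p14 : (k : ℕ) → 1 ≤ k →
    (∀ x → ⟨ S₃ k ⟩ x ⇔
       (∃ λ q → ∃ λ r → ∃ λ s → r ≤ q × x + 6 * q ≡ (s + 2 * q) * gen-a k + 2 * r))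
    × (∀ x → (4 * k + 1) * gen-a k + 3 ≤ x → ⟨ S₃ k ⟩ x)
    × IsPermutationNS 3 ⟨ S₃ k ⟩
lemma4p14 (suc k) _ =
  ⟨S₃⟩⇔Repr (suc k) ,
  conductor≤⇒∈G (suc k) ,
  record { zero∈ = gen-0 ; +-closed = gen-+ ; cofinite = _ , conductor≤⇒∈G (suc k) } ,
  enumerate (suc k) ,
  (enumerate-increasing (suc k) (s≤s z≤n) , enumerate-range k) ,
  enumerate-generates k ,
  enumerate-blocks k
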